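{- Let $\mathcal{B}$ be the set of Catalan words avoiding the pattern $(\geq,\geq)$ that do not end with two letters $ab$ satisfying $a\ge b$, and let \[ B(x,q)=\sum_{w\in\mathcal{B},\,w\ne\epsilon}x^{|w|}q^{\mathrm{area}(w)}, \] where $|w|$ is the length and $\epsilon$ the empty word. Then \[ B(x,q)=\frac{\sum_{j\geq1}(-1)^{j-1}q^{j}x^j\prod_{i=1}^{j-1}\frac{1-q^i+q^{2i}}{1-q^i}} {1-\sum_{j\geq1}(-1)^{j-1}\frac{q^{j}x^j}{1-q^j}\prod_{i=1}^{j-1}\frac{1-q^i+q^{2i}}{1-q^i}}. \] Moreover, $1+B(x,q)$ equals the infinite continued fraction \[ 1+B(x,q)=\cfrac{1}{1-\cfrac{qx}{1+qx-\cfrac{(1+qx)q^2x}{1+q^2x-\cfrac{(1+q^2x)q^3x}{\ddots}}}}, \] i.e. $1+B(x,q)=1/(1-qx/F_1)$ where $F_k=1+q^kx-\dfrac{(1+q^kx)q^{k+1}x}{F_{k+1}}$ for $k\ge1$.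
   Context: A Catalan word of length $n\ge 0$ is a sequence $w=w_1\cdots w_n$ of non-negative integers with $w_1=0$ and $0\le w_i\le w_{i-1}+1$ for $i=2,\dots,n$. It avoids the pattern $(\geq,\geq)$ if there is no index $i$ with $w_i\ge w_{i+1}\ge w_{i+2}$. $\mathrm{area}(w)=\sum_{i=1}^n(w_i+1)$, the number of cells of the bottom-aligned bargraph whose $i$-th column has $w_i+1$ cells. -}

module Defs where

open import Data.Bool using (Bool; true; false; _∧_; not; if_then_else_)
open import Data.Nat as ℕ using (ℕ; zero; suc; _∸_; _≤ᵇ_; _≡ᵇ_)
open import Data.Integer as ℤ using (ℤ; +_; -_; _+_; _*_)
open import Data.List using (List; []; _∷_; length; map; filterᵇ; concatMap; upTo)
open import Data.Nat.ListAction using (sum)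

catTail : ℕ → List ℕ → Bool
catTail p []      = true
catTail p (b ∷ w) = (b ≤ᵇ suc p) ∧ catTail b w

isCatalanᵇ : List ℕ → Bool
isCatalanᵇ []      = true
isCatalanᵇ (a ∷ w) = (a ≡ᵇ 0) ∧ catTail a w

avoidsGeGeᵇ : List ℕ → Bool
avoidsGeGeᵇ (a ∷ rest@(b ∷ c ∷ w)) = not ((b ≤ᵇ a) ∧ (c ≤ᵇ b)) ∧ avoidsGeGeᵇ rest
avoidsGeGeᵇ _ = true

goodEndingᵇ : List ℕ → Bool
goodEndingᵇ (a ∷ b ∷ [])           = not (b ≤ᵇ a)
goodEndingᵇ (a ∷ rest@(b ∷ c ∷ w)) = goodEndingᵇ rest
goodEndingᵇ _ = true

area : List ℕ → ℕ
area w = sum (map suc w)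

allWords : ℕ → ℕ → List (List ℕ)
allWords zero    k = [] ∷ []
allWords (suc n) k = concatMap (λ a → map (a ∷_) (allWords n k)) (upTo k)

inBᵇ : List ℕ → Bool
inBᵇ w = isCatalanᵇ w ∧ avoidsGeGeᵇ w ∧ goodEndingᵇ w

-- Formal power series in x and q over ℤ:  f n m = [x^n q^m] f

Series : Set
Series = ℕ → ℕ → ℤ

∑≤ : ℕ → (ℕ → ℤ) → ℤ
∑≤ zero    f = f 0
∑≤ (suc n) f = ∑≤ n f + f (suc n)

∑₁ : ℕ → (ℕ → ℤ) → ℤ
∑₁ zero    f = + 0
∑₁ (suc n) f = ∑₁ n f + f (suc n)

0s : Series
0s n m = + 0

1s : Series
1s zero zero = + 1
1s _    _    = + 0

X : Series
X 1 0 = + 1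
X _ _ = + 0

Q : Series
Q 0 1 = + 1
Q _ _ = + 0

infixl 6 _⊕_ _⊖_
infixl 7 _⊛_ _·_
infixr 8 _^s_

_⊕_ : Series → Series → Series
(f ⊕ g) n m = f n m + g n m

_⊖_ : Series → Series → Series
(f ⊖ g) n m = f n m + - g n m

_·_ : ℤ → Series → Series
(c · f) n m = c * f n m

_⊛_ : Series → Series → Series
(f ⊛ g) n m = ∑≤ n λ i → ∑≤ m λ k → f i k * g (n ∸ i) (m ∸ k)

_^s_ : Series → ℕ → Series
f ^s zero  = 1s
f ^s suc k = f ⊛ (f ^s k)

-- multiplicative inverse of a series f with constant term f 0 0 = 1:
-- 1/f = 1/(1 - E) = Σ_k E^k with E = 1 - f; since E has no constant term,
-- E^k only contributes to total degree ≥ k, so the sum at (n,m) is finite.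
inv : Series → Series
inv f n m = ∑≤ (n ℕ.+ m) λ k → ((1s ⊖ f) ^s k) n m

-- division a / f  (meaningful when f 0 0 = 1)
_⊘_ : Series → Series → Series
a ⊘ f = a ⊛ inv f

-- x-adically convergent infinite sum Σ_{j≥1} t j, for families where
-- t j only has terms of x-degree ≥ j (so [x^n] only involves j ≤ n)
∑x : (ℕ → Series) → Series
∑x t n m = ∑₁ n λ j → t j n m

∏₁ : ℕ → (ℕ → Series) → Series
∏₁ zero    f = 1s
∏₁ (suc k) f = ∏₁ k f ⊛ f (suc k)

sgn : ℕ → ℤ
sgn zero          = - (+ 1)
sgn (suc zero)    = + 1
sgn (suc (suc j)) = - sgn (suc j)

-- The generating function B(x,q) = Σ_{w ∈ 𝓑, w ≠ ε} x^|w| q^area(w)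
-- (a Catalan word of length n has entries < n, so allWords n n suffices)

Bser : Series
Bser zero    m = + 0
Bser (suc n) m =
  + length (filterᵇ (λ w → inBᵇ w ∧ (area w ≡ᵇ m)) (allWords (suc n) (suc n)))

P : ℕ → Series
P j = ∏₁ (j ∸ 1) λ i → (1s ⊖ Q ^s i ⊕ Q ^s (2 ℕ.* i)) ⊘ (1s ⊖ Q ^s i)

Num : Series
Num = ∑x λ j → sgn j · (Q ^s j ⊛ X ^s j ⊛ P j)

Den : Series
Den = 1s ⊖ ∑x λ j → sgn j · (((Q ^s j ⊛ X ^s j) ⊘ (1s ⊖ Q ^s j)) ⊛ P j)

-- truncated continued fraction:  Ftr d k = F_k with the tail F_{k+d} replaced by 1,
--   F_k = 1 + q^k x - (1 + q^k x) q^{k+1} x / F_{k+1}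
Ftr : ℕ → ℕ → Series
Ftr zero    k = 1s
Ftr (suc d) k =
  (1s ⊕ Q ^s k ⊛ X) ⊖ ((1s ⊕ Q ^s k ⊛ X) ⊛ Q ^s (suc k) ⊛ X) ⊘ Ftr d (suc k)

CF : ℕ → Series
CF d = 1s ⊘ (1s ⊖ (Q ⊛ X) ⊘ Ftr d 1)

-- The words of 𝓑 are those accepted by an automaton whose state is the last letter p together
-- with a flag telling whether the last two letters form a weak descent.  Writing Γ₀ = 1 + B and
-- Γₚ₊₁ for the generating function of accepted continuations after the letter p, the linear
-- system these satisfy collapses to the three-term recurrence
--   Γₖ = Aₖ₊₁ Γₖ₊₁ − Bₖ₊₁ Γₖ₊₂,   Aₖ = 1 + qᵏx,   Bₖ = Aₖ qᵏ⁺¹x,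
-- so the ratios Γₖ/Γₖ₊₁ solve the continued-fraction recursion Fₖ₊₁ = Aₖ₊₁ − Bₖ₊₁/Fₖ₊₂, and
-- 1 + B = 1/(1 − qx/F₁).  As every Bₖ is divisible by x, any solution of the recursion agrees
-- with the d-th truncation modulo xᵈ; this gives the convergence of the continued fraction and
-- shows that its value does not depend on the solution.  A second, explicit solution is
-- Dₖ₊₁/Eₖ₊₁ with
--   Dₖ = 1 − Σⱼ (−1)ʲ⁻¹ q⁽ᵏ⁺¹⁾ʲ xʲ Pⱼ/(1 − qʲ),   Eₖ = Σₙ (−1)ⁿ qᵏⁿ xⁿ Pₙ₊₁,
-- checked coefficientwise from Pⱼ₊₁ = Pⱼ (1 − qʲ + q²ʲ)/(1 − qʲ).  Its value is D₁/D₀, hence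
-- 1 + B = D₁/D₀, and D₀ and D₁ − D₀ are the stated denominator and numerator.

module Submission where

open import Defs
open import Algebra.Bundles using (CommutativeRing; RawRing)
open import Algebra.Solver.Ring.AlmostCommutativeRing using (fromCommutativeRing; _-Raw-AlmostCommutative⟶_)
open import Data.Bool using (Bool; true; false; _∧_; not; if_then_else_; T)
open import Data.Bool.Properties using (∧-zeroʳ; T-≡; if-float)
open import Data.Empty using (⊥-elim)
open import Data.Integer as ℤ using (ℤ; +_; -[1+_])
import Data.Integer.Properties as ℤ
open import Data.List using (List; []; _∷_; length; map; filterᵇ; concat; applyUpTo; _++_)
open import Data.Maybe using (Maybe; just; nothing)
open import Data.Nat as ℕ using (ℕ; zero; suc; _∸_; _≤_; _<_; z≤n; s≤s; _≤ᵇ_; _≡ᵇ_)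
import Data.Nat.Properties as ℕ
open import Data.Product using (_×_; ∃; _,_)
open import Data.Sum using (inj₁; inj₂)
open import Function using (_∘_; id)
open import Function.Bundles using (Equivalence)
open import Relation.Binary.PropositionalEquality as ≡ using (_≡_; refl; cong; cong₂)
import Relation.Binary.Reasoning.Setoid as ≈-Reasoning
open import Relation.Nullary using (yes; no)
open import Algebra.Properties.CommutativeSemigroup ℕ.+-commutativeSemigroup using () renaming (interchange to +-interchange)


module PowerSeries {c ℓ} (R : CommutativeRing c ℓ) where

  open CommutativeRing R renaming (refl to ≈-refl)
  open import Algebra.Properties.CommutativeSemigroup +-commutativeSemigroup using (interchange)
  import Algebra.Construct.Pointwise ℕ as Pointwise
  open ≈-Reasoning setoid

  sumTo : ℕ → (ℕ → Carrier) → Carrier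
  sumTo zero    f = f 0
  sumTo (suc n) f = sumTo n f + f (suc n)

  sumTo-cong≤ : ∀ n {f g : ℕ → Carrier} → (∀ i → i ≤ n → f i ≈ g i) → sumTo n f ≈ sumTo n g
  sumTo-cong≤ zero    f≈g = f≈g 0 z≤n
  sumTo-cong≤ (suc n) f≈g = +-cong (sumTo-cong≤ n λ i i≤n → f≈g i (ℕ.m≤n⇒m≤1+n i≤n)) (f≈g (suc n) ℕ.≤-refl)

  sumTo-cong : ∀ n {f g : ℕ → Carrier} → (∀ i → f i ≈ g i) → sumTo n f ≈ sumTo n g
  sumTo-cong n f≈g = sumTo-cong≤ n (λ i _ → f≈g i)

  sumTo-suc : ∀ n (f : ℕ → Carrier) → sumTo (suc n) f ≈ f 0 + sumTo n (f ∘ suc)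
  sumTo-suc zero    f = ≈-refl
  sumTo-suc (suc n) f = trans (+-congʳ (sumTo-suc n f)) (+-assoc _ _ _)

  sumTo-distrib-+ : ∀ n (f g : ℕ → Carrier) → sumTo n (λ i → f i + g i) ≈ sumTo n f + sumTo n g
  sumTo-distrib-+ zero    f g = ≈-refl
  sumTo-distrib-+ (suc n) f g = trans (+-congʳ (sumTo-distrib-+ n f g)) (interchange _ _ _ _)

  *-distribˡ-sumTo : ∀ n a (f : ℕ → Carrier) → a * sumTo n f ≈ sumTo n (λ i → a * f i)
  *-distribˡ-sumTo zero    a f = ≈-refl
  *-distribˡ-sumTo (suc n) a f = trans (distribˡ a _ _) (+-congʳ (*-distribˡ-sumTo n a f))

  sumTo-zero : ∀ n (f : ℕ → Carrier) → (∀ i → f i ≈ 0#) → sumTo n f ≈ 0#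
  sumTo-zero zero    f f≈0 = f≈0 0
  sumTo-zero (suc n) f f≈0 = trans (+-cong (sumTo-zero n f f≈0) (f≈0 (suc n))) (+-identityˡ 0#)

  sumTo-reverse : ∀ n (f : ℕ → Carrier) → sumTo n f ≈ sumTo n (λ i → f (n ∸ i))
  sumTo-reverse zero    f = ≈-refl
  sumTo-reverse (suc n) f = begin
    sumTo n f + f (suc n)                 ≈⟨ +-congʳ (sumTo-reverse n f) ⟩
    sumTo n (λ i → f (n ∸ i)) + f (suc n) ≈⟨ +-comm _ _ ⟩
    f (suc n) + sumTo n (λ i → f (n ∸ i)) ≈⟨ sumTo-suc n (λ i → f (suc n ∸ i)) ⟨
    sumTo (suc n) (λ i → f (suc n ∸ i))   ∎

  Ser : Set c
  Ser = ℕ → Carrier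

  infix  4 _≋_
  infixl 6 _⊞_
  infixl 7 _⊠_ _•_

  _≋_ : Ser → Ser → Set ℓ
  f ≋ g = ∀ n → f n ≈ g n

  _⊞_ : Ser → Ser → Ser
  (f ⊞ g) n = f n + g n

  ⊟_ : Ser → Ser
  (⊟ f) n = - f n

  𝟘 : Ser
  𝟘 n = 0#

  ι : Carrier → Ser
  ι a zero    = a
  ι a (suc n) = 0#

  𝟙 : Ser
  𝟙 = ι 1#

  𝕩 : Ser
  𝕩 1 = 1#
  𝕩 _ = 0#

  _•_ : Carrier → Ser → Ser
  (a • f) n = a * f n

  _⊠_ : Ser → Ser → Ser
  (f ⊠ g) n = sumTo n (λ i → f i * g (n ∸ i))

  ⊠-suc : ∀ f g n → (f ⊠ g) (suc n) ≈ f 0 * g (suc n) + ((f ∘ suc) ⊠ g) n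
  ⊠-suc f g n = sumTo-suc n (λ i → f i * g (suc n ∸ i))

  ⊠-cong : ∀ {f f′ g g′} → f ≋ f′ → g ≋ g′ → f ⊠ g ≋ f′ ⊠ g′
  ⊠-cong f≋f′ g≋g′ n = sumTo-cong n (λ i → *-cong (f≋f′ i) (g≋g′ (n ∸ i)))

  ⊠-comm : ∀ f g → f ⊠ g ≋ g ⊠ f
  ⊠-comm f g n = begin
    sumTo n (λ i → f i * g (n ∸ i))                 ≈⟨ sumTo-reverse n _ ⟩
    sumTo n (λ i → f (n ∸ i) * g (n ∸ (n ∸ i)))     ≈⟨ sumTo-cong≤ n swap ⟩
    sumTo n (λ i → g i * f (n ∸ i))                 ∎
    where
    swap : ∀ i → i ≤ n → f (n ∸ i) * g (n ∸ (n ∸ i)) ≈ g i * f (n ∸ i)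
    swap i i≤n = trans (*-comm _ _) (reflexive (≡.cong (λ k → g k * f (n ∸ i)) (ℕ.m∸[m∸n]≡n i≤n)))

  ⊠-distribʳ : ∀ h f g → (f ⊞ g) ⊠ h ≋ f ⊠ h ⊞ g ⊠ h
  ⊠-distribʳ h f g n = trans (sumTo-cong n (λ i → distribʳ _ _ _)) (sumTo-distrib-+ n _ _)

  ⊠-distribˡ : ∀ h f g → h ⊠ (f ⊞ g) ≋ h ⊠ f ⊞ h ⊠ g
  ⊠-distribˡ h f g n = trans (sumTo-cong n (λ i → distribˡ _ _ _)) (sumTo-distrib-+ n _ _)

  •-⊠ : ∀ a f g → a • f ⊠ g ≋ a • (f ⊠ g)
  •-⊠ a f g n = trans (sumTo-cong n (λ i → *-assoc _ _ _)) (sym (*-distribˡ-sumTo n a _))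

  ⊠-assoc : ∀ f g h → (f ⊠ g) ⊠ h ≋ f ⊠ (g ⊠ h)
  ⊠-assoc f g h zero    = *-assoc _ _ _
  ⊠-assoc f g h (suc n) = begin
    ((f ⊠ g) ⊠ h) (suc n)                                         ≈⟨ ⊠-suc (f ⊠ g) h n ⟩
    (f 0 * g 0) * h (suc n) + (((f ⊠ g) ∘ suc) ⊠ h) n             ≈⟨ +-congˡ (⊠-cong {g = h} (⊠-suc f g) (λ _ → ≈-refl) n) ⟩
    (f 0 * g 0) * h (suc n) + ((f 0 • (g ∘ suc) ⊞ (f ∘ suc) ⊠ g) ⊠ h) n
                                                                  ≈⟨ +-congˡ (⊠-distribʳ h _ _ n) ⟩
    (f 0 * g 0) * h (suc n) + ((f 0 • (g ∘ suc) ⊠ h) n + (((f ∘ suc) ⊠ g) ⊠ h) n)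
                                                                  ≈⟨ +-congˡ (+-cong (•-⊠ (f 0) (g ∘ suc) h n) (⊠-assoc (f ∘ suc) g h n)) ⟩
    (f 0 * g 0) * h (suc n) + (f 0 * ((g ∘ suc) ⊠ h) n + ((f ∘ suc) ⊠ (g ⊠ h)) n)
                                                                  ≈⟨ +-assoc _ _ _ ⟨
    ((f 0 * g 0) * h (suc n) + f 0 * ((g ∘ suc) ⊠ h) n) + ((f ∘ suc) ⊠ (g ⊠ h)) n
                                                                  ≈⟨ +-congʳ (trans (+-congʳ (*-assoc _ _ _)) (sym (distribˡ _ _ _))) ⟩
    f 0 * (g 0 * h (suc n) + ((g ∘ suc) ⊠ h) n) + ((f ∘ suc) ⊠ (g ⊠ h)) n
                                                                  ≈⟨ +-congʳ (*-congˡ (⊠-suc g h n)) ⟨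
    f 0 * (g ⊠ h) (suc n) + ((f ∘ suc) ⊠ (g ⊠ h)) n              ≈⟨ ⊠-suc f (g ⊠ h) n ⟨
    (f ⊠ (g ⊠ h)) (suc n)                                         ∎

  ι-⊠ : ∀ a f → ι a ⊠ f ≋ a • f
  ι-⊠ a f zero    = ≈-refl
  ι-⊠ a f (suc n) = begin
    (ι a ⊠ f) (suc n)                               ≈⟨ ⊠-suc (ι a) f n ⟩
    a * f (suc n) + sumTo n (λ i → 0# * f (n ∸ i))  ≈⟨ +-congˡ (sumTo-zero n _ (λ i → zeroˡ _)) ⟩
    a * f (suc n) + 0#                              ≈⟨ +-identityʳ _ ⟩
    a * f (suc n)                                   ∎

  ⊠-identityˡ : ∀ f → 𝟙 ⊠ f ≋ f
  ⊠-identityˡ f n = trans (ι-⊠ 1# f n) (*-identityˡ (f n))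

  ⊠-identityʳ : ∀ f → f ⊠ 𝟙 ≋ f
  ⊠-identityʳ f n = trans (⊠-comm f 𝟙 n) (⊠-identityˡ f n)

  commutativeRing : CommutativeRing c ℓ
  commutativeRing = record
    { Carrier           = Ser
    ; _≈_               = _≋_
    ; _+_               = _⊞_
    ; _*_               = _⊠_
    ; -_                = ⊟_
    ; 0#                = 𝟘
    ; 1#                = 𝟙
    ; isCommutativeRing = record
      { isRing = record
        { +-isAbelianGroup = Pointwise.isAbelianGroup +-isAbelianGroup
        ; *-cong           = ⊠-cong
        ; *-assoc          = ⊠-assoc
        ; *-identity       = ⊠-identityˡ , ⊠-identityʳ
        ; distrib          = ⊠-distribˡ , ⊠-distribʳ
        }
      ; *-comm = ⊠-comm
      }
    }

  𝕩⊠-zero : ∀ f → (𝕩 ⊠ f) 0 ≈ 0#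
  𝕩⊠-zero f = zeroˡ (f 0)

  𝕩⊠-suc : ∀ f n → (𝕩 ⊠ f) (suc n) ≈ f n
  𝕩⊠-suc f n = begin
    (𝕩 ⊠ f) (suc n)                     ≈⟨ ⊠-suc 𝕩 f n ⟩
    0# * f (suc n) + ((𝕩 ∘ suc) ⊠ f) n  ≈⟨ +-cong (zeroˡ _) (⊠-cong {g = f} 𝕩∘suc≋𝟙 (λ _ → ≈-refl) n) ⟩
    0# + (𝟙 ⊠ f) n                      ≈⟨ +-identityˡ _ ⟩
    (𝟙 ⊠ f) n                           ≈⟨ ⊠-identityˡ f n ⟩
    f n                                 ∎
    where
    𝕩∘suc≋𝟙 : 𝕩 ∘ suc ≋ 𝟙
    𝕩∘suc≋𝟙 zero    = ≈-refl
    𝕩∘suc≋𝟙 (suc k) = ≈-refl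


-- Series is literally ℤ⟦q⟧⟦x⟧.Ser, but ⊛ only agrees with ℤ⟦q⟧⟦x⟧._⊠_ coefficientwise.
module ℤ⟦q⟧ = PowerSeries ℤ.+-*-commutativeRing
module ℤ⟦q⟧⟦x⟧ = PowerSeries ℤ⟦q⟧.commutativeRing

∑≤-cong : ∀ n {f g : ℕ → ℤ} → (∀ i → f i ≡ g i) → ∑≤ n f ≡ ∑≤ n g
∑≤-cong zero    f≡g = f≡g 0
∑≤-cong (suc n) f≡g = cong₂ ℤ._+_ (∑≤-cong n f≡g) (f≡g (suc n))

∑≤-cong≤ : ∀ n {f g : ℕ → ℤ} → (∀ i → i ≤ n → f i ≡ g i) → ∑≤ n f ≡ ∑≤ n g
∑≤-cong≤ zero    f≡g = f≡g 0 z≤n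
∑≤-cong≤ (suc n) f≡g = cong₂ ℤ._+_ (∑≤-cong≤ n λ i i≤n → f≡g i (ℕ.m≤n⇒m≤1+n i≤n)) (f≡g (suc n) ℕ.≤-refl)

∑≤-zero : ∀ n {f : ℕ → ℤ} → (∀ i → i ≤ n → f i ≡ + 0) → ∑≤ n f ≡ + 0
∑≤-zero zero    f≡0 = f≡0 0 z≤n
∑≤-zero (suc n) f≡0 = cong₂ ℤ._+_ (∑≤-zero n λ i i≤n → f≡0 i (ℕ.m≤n⇒m≤1+n i≤n)) (f≡0 (suc n) ℕ.≤-refl)

∑≤-extend : ∀ {M} N {f : ℕ → ℤ} → M ≤ N → (∀ k → M < k → f k ≡ + 0) → ∑≤ N f ≡ ∑≤ M f
∑≤-extend N M≤N f≡0 with ℕ.m≤n⇒m<n∨m≡n M≤N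
... | inj₂ refl = refl
∑≤-extend (suc N) _ f≡0 | inj₁ (s≤s M≤N) =
  ≡.trans (cong₂ ℤ._+_ (∑≤-extend N M≤N f≡0) (f≡0 (suc N) (s≤s M≤N))) (ℤ.+-identityʳ _)

∑≤-distribˡ : ∀ n c (f : ℕ → ℤ) → c ℤ.* ∑≤ n f ≡ ∑≤ n (λ i → c ℤ.* f i)
∑≤-distribˡ zero    c f = refl
∑≤-distribˡ (suc n) c f = ≡.trans (ℤ.*-distribˡ-+ c (∑≤ n f) (f (suc n))) (cong (ℤ._+ c ℤ.* f (suc n)) (∑≤-distribˡ n c f))

∑≤≡sumTo : ∀ n f → ∑≤ n f ≡ ℤ⟦q⟧.sumTo n f
∑≤≡sumTo zero    f = refl
∑≤≡sumTo (suc n) f = cong (ℤ._+ f (suc n)) (∑≤≡sumTo n f)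

sumTo-coeff : ∀ n (F : ℕ → ℤ⟦q⟧.Ser) m → ℤ⟦q⟧⟦x⟧.sumTo n F m ≡ ∑≤ n (λ i → F i m)
sumTo-coeff zero    F m = refl
sumTo-coeff (suc n) F m = cong (ℤ._+ F (suc n) m) (sumTo-coeff n F m)

⊛-coeff : ∀ f g n m → (f ⊛ g) n m ≡ (f ℤ⟦q⟧⟦x⟧.⊠ g) n m
⊛-coeff f g n m = ≡.trans (∑≤-cong n (λ i → ∑≤≡sumTo m _)) (≡.sym (sumTo-coeff n _ m))

1s-coeff : ∀ n m → 1s n m ≡ ℤ⟦q⟧⟦x⟧.𝟙 n m
1s-coeff zero    zero    = refl
1s-coeff zero    (suc m) = refl
1s-coeff (suc n) m       = refl

-- A record rather than ∀ n m → f n m ≡ g n m, so that f and g can be inferred from a proof.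
infix 4 _≈_
record _≈_ (f g : Series) : Set where
  constructor mk≈
  field at : ∀ n m → f n m ≡ g n m
open _≈_

neg : Series → Series
neg f n m = ℤ.- f n m

private
  module R₂ = CommutativeRing ℤ⟦q⟧⟦x⟧.commutativeRing

  ⊛-cong : ∀ {f f′ g g′} → f ≈ f′ → g ≈ g′ → f ⊛ g ≈ f′ ⊛ g′
  ⊛-cong {f} {f′} {g} {g′} f≈f′ g≈g′ = mk≈ (begin
    f ⊛ g            ≈⟨ ⊛-coeff f g ⟩
    f ℤ⟦q⟧⟦x⟧.⊠ g    ≈⟨ R₂.*-cong (at f≈f′) (at g≈g′) ⟩
    f′ ℤ⟦q⟧⟦x⟧.⊠ g′  ≈⟨ ⊛-coeff f′ g′ ⟨
    f′ ⊛ g′          ∎)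
    where open ≈-Reasoning R₂.setoid

  ⊛-assoc : ∀ f g h → (f ⊛ g) ⊛ h ≈ f ⊛ (g ⊛ h)
  ⊛-assoc f g h = mk≈ (begin
    (f ⊛ g) ⊛ h                      ≈⟨ ⊛-coeff (f ⊛ g) h ⟩
    (f ⊛ g) ℤ⟦q⟧⟦x⟧.⊠ h              ≈⟨ R₂.*-congʳ {h} (⊛-coeff f g) ⟩
    (f ℤ⟦q⟧⟦x⟧.⊠ g) ℤ⟦q⟧⟦x⟧.⊠ h      ≈⟨ R₂.*-assoc f g h ⟩
    f ℤ⟦q⟧⟦x⟧.⊠ (g ℤ⟦q⟧⟦x⟧.⊠ h)      ≈⟨ R₂.*-congˡ {f} (⊛-coeff g h) ⟨
    f ℤ⟦q⟧⟦x⟧.⊠ (g ⊛ h)              ≈⟨ ⊛-coeff f (g ⊛ h) ⟨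
    f ⊛ (g ⊛ h)                      ∎)
    where open ≈-Reasoning R₂.setoid

  ⊛-comm : ∀ f g → f ⊛ g ≈ g ⊛ f
  ⊛-comm f g = mk≈ (begin
    f ⊛ g          ≈⟨ ⊛-coeff f g ⟩
    f ℤ⟦q⟧⟦x⟧.⊠ g  ≈⟨ R₂.*-comm f g ⟩
    g ℤ⟦q⟧⟦x⟧.⊠ f  ≈⟨ ⊛-coeff g f ⟨
    g ⊛ f          ∎)
    where open ≈-Reasoning R₂.setoid

  ⊛-identityˡ : ∀ f → 1s ⊛ f ≈ f
  ⊛-identityˡ f = mk≈ (begin
    1s ⊛ f          ≈⟨ ⊛-coeff 1s f ⟩
    1s ℤ⟦q⟧⟦x⟧.⊠ f  ≈⟨ R₂.*-congʳ {f} 1s-coeff ⟩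
    R₂.1# R₂.* f    ≈⟨ R₂.*-identityˡ f ⟩
    f               ∎)
    where open ≈-Reasoning R₂.setoid

  ⊛-identityʳ : ∀ f → f ⊛ 1s ≈ f
  ⊛-identityʳ f = mk≈ λ n m → ≡.trans (at (⊛-comm f 1s) n m) (at (⊛-identityˡ f) n m)

  ⊛-distribˡ : ∀ h f g → h ⊛ (f ⊕ g) ≈ h ⊛ f ⊕ h ⊛ g
  ⊛-distribˡ h f g = mk≈ (begin
    h ⊛ (f ⊕ g)                          ≈⟨ ⊛-coeff h (f ⊕ g) ⟩
    h ℤ⟦q⟧⟦x⟧.⊠ (f ⊕ g)                  ≈⟨ R₂.distribˡ h f g ⟩
    h ℤ⟦q⟧⟦x⟧.⊠ f R₂.+ h ℤ⟦q⟧⟦x⟧.⊠ g     ≈⟨ R₂.+-cong (⊛-coeff h f) (⊛-coeff h g) ⟨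
    h ⊛ f ⊕ h ⊛ g                        ∎)
    where open ≈-Reasoning R₂.setoid

  ⊛-distribʳ : ∀ h f g → (f ⊕ g) ⊛ h ≈ f ⊛ h ⊕ g ⊛ h
  ⊛-distribʳ h f g = mk≈ λ n m → ≡.trans (at (⊛-comm (f ⊕ g) h) n m)
    (≡.trans (at (⊛-distribˡ h f g) n m) (cong₂ ℤ._+_ (at (⊛-comm h f) n m) (at (⊛-comm h g) n m)))

seriesRing : CommutativeRing _ _
seriesRing = record
  { Carrier           = Series
  ; _≈_               = _≈_
  ; _+_               = _⊕_
  ; _*_               = _⊛_
  ; -_                = neg
  ; 0#                = 0s
  ; 1#                = 1s
  ; isCommutativeRing = record
    { isRing = record
      { +-isAbelianGroup = record
        { isGroup = record
          { isMonoid = record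
            { isSemigroup = record
              { isMagma = record
                { isEquivalence = record
                  { refl  = mk≈ λ _ _ → refl
                  ; sym   = λ f≈g → mk≈ λ n m → ≡.sym (at f≈g n m)
                  ; trans = λ f≈g g≈h → mk≈ λ n m → ≡.trans (at f≈g n m) (at g≈h n m)
                  }
                ; ∙-cong = λ f≈f′ g≈g′ → mk≈ λ n m → cong₂ ℤ._+_ (at f≈f′ n m) (at g≈g′ n m)
                }
              ; assoc = λ f g h → mk≈ λ n m → ℤ.+-assoc (f n m) (g n m) (h n m)
              }
            ; identity = (λ f → mk≈ λ n m → ℤ.+-identityˡ (f n m))
                       , (λ f → mk≈ λ n m → ℤ.+-identityʳ (f n m))
            }
          ; inverse = (λ f → mk≈ λ n m → ℤ.+-inverseˡ (f n m))
                    , (λ f → mk≈ λ n m → ℤ.+-inverseʳ (f n m))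
          ; ⁻¹-cong = λ f≈g → mk≈ λ n m → cong ℤ.-_ (at f≈g n m)
          }
        ; comm = λ f g → mk≈ λ n m → ℤ.+-comm (f n m) (g n m)
        }
      ; *-cong     = ⊛-cong
      ; *-assoc    = ⊛-assoc
      ; *-identity = ⊛-identityˡ , ⊛-identityʳ
      ; distrib    = ⊛-distribˡ , ⊛-distribʳ
      }
    ; *-comm = ⊛-comm
    }
  }

open CommutativeRing seriesRing
  using ( setoid; +-cong; +-congˡ; +-congʳ; +-identityʳ; -‿cong; -‿inverseʳ
        ; *-cong; *-congˡ; *-congʳ; *-assoc; *-comm; *-identityˡ; *-identityʳ; distribˡ; zeroʳ )
  renaming (refl to ≈-refl; sym to ≈-sym; trans to ≈-trans; reflexive to ≈-reflexive)

·-⊛ : ∀ c f g → (c · f) ⊛ g ≈ c · (f ⊛ g)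
·-⊛ c f g = mk≈ λ n m → ≡.sym (≡.trans (∑≤-distribˡ n c _) (∑≤-cong n λ i →
  ≡.trans (∑≤-distribˡ m c _) (∑≤-cong m λ l → ≡.sym (ℤ.*-assoc c _ _))))

·-cong : ∀ c {f g} → f ≈ g → c · f ≈ c · g
·-cong c f≈g = mk≈ λ n m → cong (c ℤ.*_) (at f≈g n m)

·-as-⊛ : ∀ c f → c · f ≈ (c · 1s) ⊛ f
·-as-⊛ c f = ≈-sym (≈-trans (·-⊛ c 1s f) (·-cong c (*-identityˡ f)))

-- The solver's embedding of coefficients must send + 1 to 1s itself, not to + 1 · 1s,
-- so that the solved equations match goals written with 1s.
constant : ℤ → Series
constant (+ 1) = 1s
constant c     = c · 1s

constant≈· : ∀ c → constant c ≈ c · 1s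
constant≈· (+ 0)           = ≈-refl
constant≈· (+ 1)           = mk≈ λ n m → ≡.sym (ℤ.*-identityˡ (1s n m))
constant≈· (+ suc (suc k)) = ≈-refl
constant≈· -[1+ k ]        = ≈-refl

private
  ℤ-rawRing : RawRing _ _
  ℤ-rawRing = CommutativeRing.rawRing ℤ.+-*-commutativeRing

  ·1s-*-homo : ∀ a b → (a ℤ.* b) · 1s ≈ (a · 1s) ⊛ (b · 1s)
  ·1s-*-homo a b = ≈-trans (mk≈ λ n m → ℤ.*-assoc a b (1s n m))
    (≈-trans (·-cong a (≈-sym (*-identityˡ (b · 1s)))) (≈-sym (·-⊛ a 1s (b · 1s))))

  constant-homomorphism : ℤ-rawRing -Raw-AlmostCommutative⟶ fromCommutativeRing seriesRing
  constant-homomorphism = record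
    { ⟦_⟧    = constant
    ; +-homo = λ a b → via (constant≈· (a ℤ.+ b)) (mk≈ λ n m → ℤ.*-distribʳ-+ (1s n m) a b)
                           (+-cong (constant≈· a) (constant≈· b))
    ; *-homo = λ a b → via (constant≈· (a ℤ.* b)) (·1s-*-homo a b) (*-cong (constant≈· a) (constant≈· b))
    ; -‿homo = λ a → via (constant≈· (ℤ.- a)) (mk≈ λ n m → ≡.sym (ℤ.neg-distribˡ-* a (1s n m))) (-‿cong (constant≈· a))
    ; 0-homo = ≈-trans (constant≈· (+ 0)) (mk≈ λ n m → ℤ.*-zeroˡ (1s n m))
    ; 1-homo = ≈-refl
    }
    where
    via : ∀ {u u′ v v′} → u ≈ u′ → u′ ≈ v′ → v ≈ v′ → u ≈ v
    via u≈u′ u′≈v′ v≈v′ = ≈-trans u≈u′ (≈-trans u′≈v′ (≈-sym v≈v′))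

  constant-≟ : ∀ a b → Maybe (constant a ≈ constant b)
  constant-≟ a b with a ℤ.≟ b
  ... | yes refl = just ≈-refl
  ... | no _     = nothing

open import Algebra.Solver.Ring ℤ-rawRing (fromCommutativeRing seriesRing) constant-homomorphism constant-≟
  using (solve; _:=_; _:+_; _:*_; _:-_; :-_; con)

linear-combination : ∀ {x y l₁ r₁ l₂ r₂ l₃ r₃} c₁ c₂ c₃ → l₁ ≈ r₁ → l₂ ≈ r₂ → l₃ ≈ r₃ →
                     x ⊖ y ≈ c₁ ⊛ (l₁ ⊖ r₁) ⊕ c₂ ⊛ (l₂ ⊖ r₂) ⊕ c₃ ⊛ (l₃ ⊖ r₃) → x ≈ y
linear-combination {x} {y} {l₁} {r₁} {l₂} {r₂} {l₃} {r₃} c₁ c₂ c₃ e₁ e₂ e₃ x-y≈ = begin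
  x                                                        ≈⟨ solve 2 (λ x y → x := y :+ (x :- y)) ≈-refl x y ⟩
  y ⊕ (x ⊖ y)                                              ≈⟨ +-congˡ {y} x-y≈ ⟩
  y ⊕ (c₁ ⊛ (l₁ ⊖ r₁) ⊕ c₂ ⊛ (l₂ ⊖ r₂) ⊕ c₃ ⊛ (l₃ ⊖ r₃))    ≈⟨ +-congˡ {y} (+-cong (+-cong (vanish c₁ e₁) (vanish c₂ e₂))
                                                                                   (vanish c₃ e₃)) ⟩
  y ⊕ (0s ⊕ 0s ⊕ 0s)                                       ≈⟨ solve 1 (λ y → y :+ (con (+ 0) :+ con (+ 0) :+ con (+ 0)) := y) ≈-refl y ⟩
  y                                                        ∎
  where
  open ≈-Reasoning setoid
  vanish : ∀ c {l r} → l ≈ r → c ⊛ (l ⊖ r) ≈ 0s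
  vanish c {l} {r} l≈r = ≈-trans (*-congˡ {c} (≈-trans (+-congʳ l≈r) (-‿inverseʳ r))) (zeroʳ c)


-- Inverses of series with constant term 1

ConstOne : Series → Set
ConstOne f = f 0 0 ≡ + 1

Order≥ : ℕ → Series → Set
Order≥ k f = ∀ n m → n ℕ.+ m < k → f n m ≡ + 0

order-⊛ : ∀ {a b f g} → Order≥ a f → Order≥ b g → Order≥ (a ℕ.+ b) (f ⊛ g)
order-⊛ {a} {b} {f} {g} f≥a g≥b n m n+m<a+b =
  ∑≤-zero n λ i i≤n → ∑≤-zero m λ l l≤m → term i l i≤n l≤m
  where
  term : ∀ i l → i ≤ n → l ≤ m → f i l ℤ.* g (n ∸ i) (m ∸ l) ≡ + 0
  term i l i≤n l≤m with i ℕ.+ l ℕ.<? a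
  ... | yes i+l<a = ≡.trans (cong (ℤ._* _) (f≥a i l i+l<a)) (ℤ.*-zeroˡ (g (n ∸ i) (m ∸ l)))
  ... | no  i+l≮a = ≡.trans (cong (f i l ℤ.*_) (g≥b (n ∸ i) (m ∸ l) rest<b)) (ℤ.*-zeroʳ (f i l))
    where
    rest = (n ∸ i) ℕ.+ (m ∸ l)
    rest<b : rest < b
    rest<b = ℕ.+-cancelʳ-< (i ℕ.+ l) rest b (begin-strict
      rest ℕ.+ (i ℕ.+ l)                  ≡⟨ +-interchange (n ∸ i) (m ∸ l) i l ⟩
      (n ∸ i ℕ.+ i) ℕ.+ (m ∸ l ℕ.+ l)     ≡⟨ cong₂ ℕ._+_ (ℕ.m∸n+n≡m i≤n) (ℕ.m∸n+n≡m l≤m) ⟩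
      n ℕ.+ m                             <⟨ n+m<a+b ⟩
      a ℕ.+ b                             ≤⟨ ℕ.+-monoˡ-≤ b (ℕ.≮⇒≥ i+l≮a) ⟩
      (i ℕ.+ l) ℕ.+ b                     ≡⟨ ℕ.+-comm (i ℕ.+ l) b ⟩
      b ℕ.+ (i ℕ.+ l)                     ∎)
      where open ℕ.≤-Reasoning

order-^s : ∀ {e} → Order≥ 1 e → ∀ k → Order≥ k (e ^s k)
order-^s e≥1 zero    n m ()
order-^s e≥1 (suc k) = order-⊛ e≥1 (order-^s e≥1 k)

order-1s⊖ : ∀ {f} → ConstOne f → Order≥ 1 (1s ⊖ f)
order-1s⊖ f₀ zero    zero    _ rewrite f₀ = refl
order-1s⊖ f₀ zero    (suc m) (s≤s ())
order-1s⊖ f₀ (suc n) m       (s≤s ())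

∑≤ˢ : ℕ → (ℕ → Series) → Series
∑≤ˢ N F n m = ∑≤ N (λ k → F k n m)

geometric-telescope : ∀ e N → (1s ⊖ e) ⊛ ∑≤ˢ N (e ^s_) ≈ 1s ⊖ e ^s suc N
geometric-telescope e zero    = solve 1 (λ e → (con (+ 1) :- e) :* con (+ 1) := con (+ 1) :- e :* con (+ 1)) ≈-refl e
geometric-telescope e (suc N) = begin
  (1s ⊖ e) ⊛ (S ⊕ t)           ≈⟨ solve 3 (λ e S t → (con (+ 1) :- e) :* (S :+ t) := (con (+ 1) :- e) :* S :+ (t :- e :* t)) ≈-refl e S t ⟩
  (1s ⊖ e) ⊛ S ⊕ (t ⊖ e ⊛ t)   ≈⟨ +-congʳ (geometric-telescope e N) ⟩
  (1s ⊖ t) ⊕ (t ⊖ e ⊛ t)       ≈⟨ solve 2 (λ e t → (con (+ 1) :- t) :+ (t :- e :* t) := con (+ 1) :- e :* t) ≈-refl e t ⟩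
  1s ⊖ e ⊛ t                   ∎
  where
  open ≈-Reasoning setoid
  S = ∑≤ˢ N (e ^s_)
  t = e ^s suc N

inv-partialSum : ∀ {f} → ConstOne f → ∀ N n m → n ℕ.+ m ≤ N → ∑≤ˢ N ((1s ⊖ f) ^s_) n m ≡ inv f n m
inv-partialSum {f} f₀ N n m n+m≤N = ∑≤-extend N n+m≤N (λ k n+m<k → order-^s (order-1s⊖ f₀) k n m n+m<k)

⊛-inverseʳ : ∀ f → ConstOne f → f ⊛ inv f ≈ 1s
⊛-inverseʳ f f₀ = mk≈ λ n m → let N = n ℕ.+ m; S = ∑≤ˢ N (e ^s_) in begin
  (f ⊛ inv f) n m      ≡⟨ ∑≤-cong n (λ i → ∑≤-cong m (λ l → cong (f i l ℤ.*_) (≡.sym (inv-partialSum f₀ N (n ∸ i) (m ∸ l)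
                            (ℕ.+-mono-≤ (ℕ.m∸n≤m n i) (ℕ.m∸n≤m m l)))))) ⟩
  (f ⊛ S) n m          ≡⟨ at (*-congʳ {S} f≈1-e) n m ⟩
  ((1s ⊖ e) ⊛ S) n m   ≡⟨ at (geometric-telescope e N) n m ⟩
  1s n m ℤ.+ ℤ.- (e ^s suc N) n m  ≡⟨ cong (λ z → 1s n m ℤ.+ ℤ.- z) (order-^s (order-1s⊖ f₀) (suc N) n m ℕ.≤-refl) ⟩
  1s n m ℤ.+ ℤ.- + 0     ≡⟨ ℤ.+-identityʳ (1s n m) ⟩
  1s n m               ∎
  where
  open ≡.≡-Reasoning
  e = 1s ⊖ f
  f≈1-e : f ≈ 1s ⊖ e
  f≈1-e = solve 1 (λ f → f := con (+ 1) :- (con (+ 1) :- f)) ≈-refl f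

⊛-inverseˡ : ∀ f → ConstOne f → inv f ⊛ f ≈ 1s
⊛-inverseˡ f f₀ = ≈-trans (*-comm (inv f) f) (⊛-inverseʳ f f₀)

^s-cong : ∀ {f g} k → f ≈ g → f ^s k ≈ g ^s k
^s-cong zero    f≈g = ≈-refl
^s-cong (suc k) f≈g = *-cong f≈g (^s-cong k f≈g)

^s-+ : ∀ f a b → f ^s (a ℕ.+ b) ≈ f ^s a ⊛ f ^s b
^s-+ f zero    b = ≈-sym (*-identityˡ (f ^s b))
^s-+ f (suc a) b = ≈-trans (*-congˡ {f} (^s-+ f a b)) (≈-sym (*-assoc f (f ^s a) (f ^s b)))

inv-cong : ∀ {f g} → f ≈ g → inv f ≈ inv g
inv-cong f≈g = mk≈ λ n m → ∑≤-cong (n ℕ.+ m) λ k → at (^s-cong k (+-congˡ {1s} (-‿cong f≈g))) n m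

constOne-⊛ : ∀ f g → ConstOne f → ConstOne g → ConstOne (f ⊛ g)
constOne-⊛ f g f₀ g₀ = cong₂ ℤ._*_ f₀ g₀

constOne-inv : ∀ f → ConstOne (inv f)
constOne-inv f = refl

⊘-unique : ∀ f {g a} → ConstOne f → g ⊛ f ≈ a → g ≈ a ⊘ f
⊘-unique f {g} {a} f₀ g*f≈a = begin
  g                  ≈⟨ *-identityʳ g ⟨
  g ⊛ 1s             ≈⟨ *-congˡ {g} (⊛-inverseʳ f f₀) ⟨
  g ⊛ (f ⊛ inv f)    ≈⟨ *-assoc g f (inv f) ⟨
  (g ⊛ f) ⊛ inv f    ≈⟨ *-congʳ {inv f} g*f≈a ⟩
  a ⊘ f              ∎
  where open ≈-Reasoning setoid

inv-unique : ∀ f {g} → ConstOne f → g ⊛ f ≈ 1s → inv f ≈ g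
inv-unique f {g} f₀ g*f≈1 = ≈-sym (≈-trans (⊘-unique f f₀ g*f≈1) (*-identityˡ (inv f)))

inv-involutive : ∀ f → ConstOne f → inv (inv f) ≈ f
inv-involutive f f₀ = inv-unique (inv f) (constOne-inv f) (⊛-inverseʳ f f₀)

inv-⊛ : ∀ f g → ConstOne f → ConstOne g → inv (f ⊛ g) ≈ inv f ⊛ inv g
inv-⊛ f g f₀ g₀ = inv-unique (f ⊛ g) (constOne-⊛ f g f₀ g₀) (begin
  (inv f ⊛ inv g) ⊛ (f ⊛ g)    ≈⟨ solve 4 (λ a b c d → (a :* b) :* (c :* d) := (c :* a) :* (d :* b)) ≈-refl (inv f) (inv g) f g ⟩
  (f ⊛ inv f) ⊛ (g ⊛ inv g)    ≈⟨ *-cong (⊛-inverseʳ f f₀) (⊛-inverseʳ g g₀) ⟩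
  1s ⊛ 1s                      ≈⟨ *-identityˡ 1s ⟩
  1s                           ∎)
  where open ≈-Reasoning setoid

inv-⊘ : ∀ f g → ConstOne f → ConstOne g → inv (f ⊘ g) ≈ g ⊘ f
inv-⊘ f g f₀ g₀ = begin
  inv (f ⊛ inv g)          ≈⟨ inv-⊛ f (inv g) f₀ (constOne-inv g) ⟩
  inv f ⊛ inv (inv g)      ≈⟨ *-congˡ {inv f} (inv-involutive g g₀) ⟩
  inv f ⊛ g                ≈⟨ *-comm (inv f) g ⟩
  g ⊘ f                    ∎
  where open ≈-Reasoning setoid

⊘-⊛-cancel : ∀ a f → ConstOne f → (a ⊘ f) ⊛ f ≈ a
⊘-⊛-cancel a f f₀ = ≈-trans (*-assoc a (inv f) f) (≈-trans (*-congˡ {a} (⊛-inverseˡ f f₀)) (*-identityʳ a))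

⊘-identityʳ : ∀ f → f ⊘ 1s ≈ f
⊘-identityʳ f = ≈-trans (*-congˡ {f} (inv-unique 1s {1s} refl (*-identityˡ 1s))) (*-identityʳ f)

⊘-⊘ : ∀ h f g → ConstOne f → ConstOne g → h ⊘ (f ⊘ g) ≈ (h ⊛ g) ⊘ f
⊘-⊘ h f g f₀ g₀ = ≈-trans (*-congˡ {h} (inv-⊘ f g f₀ g₀)) (≈-sym (*-assoc h g (inv f)))

-- Defs gives ⊘ no fixity, so it binds tighter than ⊕, ⊖ and ⊛: f ⊖ h ⊘ g is f − h/g.
⊖-⊘ : ∀ f h g → ConstOne g → f ⊖ h ⊘ g ≈ (f ⊛ g ⊖ h) ⊘ g
⊖-⊘ f h g g₀ = begin
  f ⊖ h ⊘ g                    ≈⟨ +-congʳ (≈-trans (*-congˡ {f} (⊛-inverseʳ g g₀)) (*-identityʳ f)) ⟨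
  f ⊛ (g ⊛ inv g) ⊖ h ⊘ g      ≈⟨ solve 4 (λ f g h i → f :* (g :* i) :- h :* i := (f :* g :- h) :* i) ≈-refl f g h (inv g) ⟩
  (f ⊛ g ⊖ h) ⊘ g              ∎
  where open ≈-Reasoning setoid

⊘-cancelˡ : ∀ a d e → ConstOne a → ConstOne e → (a ⊛ d) ⊘ (a ⊛ e) ≈ d ⊘ e
⊘-cancelˡ a d e a₀ e₀ = begin
  (a ⊛ d) ⊛ inv (a ⊛ e)          ≈⟨ *-congˡ {a ⊛ d} (inv-⊛ a e a₀ e₀) ⟩
  (a ⊛ d) ⊛ (inv a ⊛ inv e)      ≈⟨ solve 4 (λ a d i j → (a :* d) :* (i :* j) := (a :* i) :* (d :* j)) ≈-refl a d (inv a) (inv e) ⟩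
  (a ⊛ inv a) ⊛ (d ⊘ e)          ≈⟨ *-congʳ {d ⊘ e} (⊛-inverseʳ a a₀) ⟩
  1s ⊛ (d ⊘ e)                   ≈⟨ *-identityˡ (d ⊘ e) ⟩
  d ⊘ e                          ∎
  where open ≈-Reasoning setoid

cancel-inverse : ∀ g {x y} z → ConstOne g → x ≈ y ⊕ z ⊛ (1s ⊖ g ⊛ inv g) → x ≈ y
cancel-inverse g {x} {y} z g₀ x≈ = begin
  x                              ≈⟨ x≈ ⟩
  y ⊕ z ⊛ (1s ⊖ g ⊛ inv g)       ≈⟨ +-congˡ {y} (*-congˡ {z} (+-congˡ {1s} (-‿cong (⊛-inverseʳ g g₀)))) ⟩
  y ⊕ z ⊛ (1s ⊖ 1s)              ≈⟨ +-congˡ {y} (*-congˡ {z} (-‿inverseʳ 1s)) ⟩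
  y ⊕ z ⊛ 0s                     ≈⟨ +-congˡ {y} (zeroʳ z) ⟩
  y ⊕ 0s                         ≈⟨ +-identityʳ y ⟩
  y                              ∎
  where open ≈-Reasoning setoid


X-coeff : ∀ n m → X n m ≡ ℤ⟦q⟧⟦x⟧.𝕩 n m
X-coeff 0             m       = refl
X-coeff 1             zero    = refl
X-coeff 1             (suc m) = refl
X-coeff (suc (suc n)) m       = refl

Q-coeff : ∀ n m → Q n m ≡ ℤ⟦q⟧⟦x⟧.ι ℤ⟦q⟧.𝕩 n m
Q-coeff zero    0             = refl
Q-coeff zero    1             = refl
Q-coeff zero    (suc (suc m)) = refl
Q-coeff (suc n) m             = refl

⊛-coeffˡ : ∀ {f f′} → (∀ n m → f n m ≡ f′ n m) → ∀ g n m → (f ⊛ g) n m ≡ (f′ ℤ⟦q⟧⟦x⟧.⊠ g) n m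
⊛-coeffˡ {f} {f′} f≡f′ g n m = ≡.trans (at (*-congʳ {g} (mk≈ f≡f′)) n m) (⊛-coeff f′ g n m)

X⊛-coeff-zero : ∀ f m → (X ⊛ f) 0 m ≡ + 0
X⊛-coeff-zero f m = ≡.trans (⊛-coeffˡ X-coeff f 0 m) (ℤ⟦q⟧⟦x⟧.𝕩⊠-zero f m)

X⊛-coeff-suc : ∀ f n m → (X ⊛ f) (suc n) m ≡ f n m
X⊛-coeff-suc f n m = ≡.trans (⊛-coeffˡ X-coeff f (suc n) m) (ℤ⟦q⟧⟦x⟧.𝕩⊠-suc f n m)

Q⊛-coeff : ∀ f n m → (Q ⊛ f) n m ≡ (ℤ⟦q⟧.𝕩 ℤ⟦q⟧.⊠ f n) m
Q⊛-coeff f n m = ≡.trans (⊛-coeffˡ Q-coeff f n m) (ℤ⟦q⟧⟦x⟧.ι-⊠ ℤ⟦q⟧.𝕩 f n m)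

Q⊛-coeff-zero : ∀ f n → (Q ⊛ f) n 0 ≡ + 0
Q⊛-coeff-zero f n = ≡.trans (Q⊛-coeff f n 0) (ℤ⟦q⟧.𝕩⊠-zero (f n))

Q⊛-coeff-suc : ∀ f n m → (Q ⊛ f) n (suc m) ≡ f n m
Q⊛-coeff-suc f n m = ≡.trans (Q⊛-coeff f n (suc m)) (ℤ⟦q⟧.𝕩⊠-suc (f n) m)

Q^⊛-coeff-≥ : ∀ k f n {m} → k ≤ m → (Q ^s k ⊛ f) n m ≡ f n (m ∸ k)
Q^⊛-coeff-≥ zero    f n {m}     _         = at (*-identityˡ f) n m
Q^⊛-coeff-≥ (suc k) f n {suc m} (s≤s k≤m) = ≡.trans (at (*-assoc Q (Q ^s k) f) n (suc m))
  (≡.trans (Q⊛-coeff-suc (Q ^s k ⊛ f) n m) (Q^⊛-coeff-≥ k f n k≤m))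

Q^⊛-coeff-< : ∀ k f n {m} → m < k → (Q ^s k ⊛ f) n m ≡ + 0
Q^⊛-coeff-< (suc k) f n {zero}  _         = ≡.trans (at (*-assoc Q (Q ^s k) f) n 0) (Q⊛-coeff-zero (Q ^s k ⊛ f) n)
Q^⊛-coeff-< (suc k) f n {suc m} (s≤s m<k) = ≡.trans (at (*-assoc Q (Q ^s k) f) n (suc m))
  (≡.trans (Q⊛-coeff-suc (Q ^s k ⊛ f) n m) (Q^⊛-coeff-< k f n m<k))

Q^⊛-coeff : ∀ k f n m → (Q ^s k ⊛ f) n m ≡ (if k ℕ.≤ᵇ m then f n (m ∸ k) else + 0)
Q^⊛-coeff k f n m with k ℕ.≤ᵇ m in k≤ᵇm
... | true  = Q^⊛-coeff-≥ k f n (ℕ.≤ᵇ⇒≤ k m (Equivalence.from T-≡ k≤ᵇm))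
... | false = Q^⊛-coeff-< k f n (ℕ.≰⇒> λ k≤m → ≡.subst T k≤ᵇm (ℕ.≤⇒≤ᵇ k≤m))

X^⊛-coeff-≥ : ∀ k f {n} m → k ≤ n → (X ^s k ⊛ f) n m ≡ f (n ∸ k) m
X^⊛-coeff-≥ zero    f {n}     m _         = at (*-identityˡ f) n m
X^⊛-coeff-≥ (suc k) f {suc n} m (s≤s k≤n) = ≡.trans (at (*-assoc X (X ^s k) f) (suc n) m)
  (≡.trans (X⊛-coeff-suc (X ^s k ⊛ f) n m) (X^⊛-coeff-≥ k f m k≤n))


-- Agreement modulo x^d

infix 4 _≈[_]_
record _≈[_]_ (f : Series) (d : ℕ) (g : Series) : Set where
  constructor mk≈[]
  field at< : ∀ n m → n < d → f n m ≡ g n m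
open _≈[_]_

≈⇒≈[] : ∀ {d f g} → f ≈ g → f ≈[ d ] g
≈⇒≈[] f≈g = mk≈[] λ n m _ → at f≈g n m

≈[]-refl : ∀ {d} f → f ≈[ d ] f
≈[]-refl f = mk≈[] λ _ _ _ → refl

≈[]-sym : ∀ {d f g} → f ≈[ d ] g → g ≈[ d ] f
≈[]-sym f≈g = mk≈[] λ n m n<d → ≡.sym (at< f≈g n m n<d)

≈[]-trans : ∀ {d f g h} → f ≈[ d ] g → g ≈[ d ] h → f ≈[ d ] h
≈[]-trans f≈g g≈h = mk≈[] λ n m n<d → ≡.trans (at< f≈g n m n<d) (at< g≈h n m n<d)

≈[]-zero : ∀ {f g} → f ≈[ 0 ] g
≈[]-zero = mk≈[] λ _ _ ()

≈[]-all⇒≈ : ∀ {f g} → (∀ d → f ≈[ d ] g) → f ≈ g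
≈[]-all⇒≈ f≈g = mk≈ λ n m → at< (f≈g (suc n)) n m ℕ.≤-refl

⊖-cong[] : ∀ {d f f′ g g′} → f ≈[ d ] f′ → g ≈[ d ] g′ → f ⊖ g ≈[ d ] f′ ⊖ g′
⊖-cong[] f≈f′ g≈g′ = mk≈[] λ n m n<d → cong₂ ℤ._+_ (at< f≈f′ n m n<d) (cong ℤ.-_ (at< g≈g′ n m n<d))

⊛-cong[] : ∀ {d f f′ g g′} → f ≈[ d ] f′ → g ≈[ d ] g′ → f ⊛ g ≈[ d ] f′ ⊛ g′
⊛-cong[] f≈f′ g≈g′ = mk≈[] λ n m n<d → ∑≤-cong≤ n λ i i≤n → ∑≤-cong m λ l →
  cong₂ ℤ._*_ (at< f≈f′ i l (ℕ.≤-<-trans i≤n n<d)) (at< g≈g′ (n ∸ i) (m ∸ l) (ℕ.≤-<-trans (ℕ.m∸n≤m n i) n<d))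

^s-cong[] : ∀ {d f g} k → f ≈[ d ] g → f ^s k ≈[ d ] g ^s k
^s-cong[] zero    f≈g = ≈[]-refl 1s
^s-cong[] (suc k) f≈g = ⊛-cong[] f≈g (^s-cong[] k f≈g)

inv-cong[] : ∀ {d f g} → f ≈[ d ] g → inv f ≈[ d ] inv g
inv-cong[] f≈g = mk≈[] λ n m n<d → ∑≤-cong (n ℕ.+ m) λ k → at< (^s-cong[] k (⊖-cong[] (≈[]-refl 1s) f≈g)) n m n<d

⊘-cong[] : ∀ {d f f′ g g′} → f ≈[ d ] f′ → g ≈[ d ] g′ → f ⊘ g ≈[ d ] f′ ⊘ g′
⊘-cong[] f≈f′ g≈g′ = ⊛-cong[] f≈f′ (inv-cong[] g≈g′)

X⊛-cong[] : ∀ {d f g} → f ≈[ d ] g → X ⊛ f ≈[ suc d ] X ⊛ g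
X⊛-cong[] {f = f} {g} f≈g = mk≈[] λ where
  zero    m _         → ≡.trans (X⊛-coeff-zero f m) (≡.sym (X⊛-coeff-zero g m))
  (suc n) m (s≤s n<d) → ≡.trans (X⊛-coeff-suc f n m) (≡.trans (at< f≈g n m n<d) (≡.sym (X⊛-coeff-suc g n m)))


-- The continued fraction

A : ℕ → Series
A k = 1s ⊕ Q ^s k ⊛ X

B : ℕ → Series
B k = A k ⊛ Q ^s suc k ⊛ X

constOne-A : ∀ k → ConstOne (A k)
constOne-A k = cong (ℤ._+_ (+ 1)) (ℤ.*-zeroʳ ((Q ^s k) 0 0))

Riccati : (ℕ → Series) → Set
Riccati Φ = ∀ k → Φ k ≈ A (suc k) ⊖ B (suc k) ⊘ Φ (suc k)

cfValue : Series → Series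
cfValue F = 1s ⊘ (1s ⊖ (Q ⊛ X) ⊘ F)

B⊘-cong[] : ∀ k {d F G} → F ≈[ d ] G → B k ⊘ F ≈[ suc d ] B k ⊘ G
B⊘-cong[] k {F = F} {G} F≈G =
  ≈[]-trans (≈⇒≈[] (x-out F))
    (≈[]-trans (X⊛-cong[] (⊛-cong[] (≈[]-refl (A k ⊛ Q ^s suc k)) (inv-cong[] F≈G))) (≈[]-sym (≈⇒≈[] (x-out G))))
  where
  x-out : ∀ H → B k ⊘ H ≈ X ⊛ ((A k ⊛ Q ^s suc k) ⊛ inv H)
  x-out H = solve 4 (λ a q x i → (a :* q :* x) :* i := x :* ((a :* q) :* i)) ≈-refl (A k) (Q ^s suc k) X (inv H)

Ftr-≈[] : ∀ {Φ} → Riccati Φ → ∀ d k → Ftr d (suc k) ≈[ d ] Φ k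
Ftr-≈[] Φ-ric zero    k = ≈[]-zero
Ftr-≈[] Φ-ric (suc d) k =
  ≈[]-trans (⊖-cong[] (≈[]-refl (A (suc k))) (B⊘-cong[] (suc k) (Ftr-≈[] Φ-ric d (suc k)))) (≈[]-sym (≈⇒≈[] (Φ-ric k)))

CF-≈[] : ∀ {Φ} → Riccati Φ → ∀ d → CF d ≈[ d ] cfValue (Φ 0)
CF-≈[] Φ-ric d = ⊘-cong[] (≈[]-refl 1s) (⊖-cong[] (≈[]-refl 1s) (⊘-cong[] (≈[]-refl (Q ⊛ X)) (Ftr-≈[] Φ-ric d 0)))

cfValue-unique : ∀ {Φ Ψ} → Riccati Φ → Riccati Ψ → cfValue (Φ 0) ≈ cfValue (Ψ 0)
cfValue-unique Φ-ric Ψ-ric = ≈[]-all⇒≈ λ d → ≈[]-trans (≈[]-sym (CF-≈[] Φ-ric d)) (CF-≈[] Ψ-ric d)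

ratio-step : ∀ a b {g₀} g₁ g₂ → ConstOne g₁ → ConstOne g₂ →
             g₀ ≈ a ⊛ g₁ ⊖ b ⊛ g₂ → g₀ ⊘ g₁ ≈ a ⊖ b ⊘ (g₁ ⊘ g₂)
ratio-step a b {g₀} g₁ g₂ g₁₀ g₂₀ g₀≈ = begin
  g₀ ⊘ g₁                      ≈⟨ *-congʳ {inv g₁} g₀≈ ⟩
  (a ⊛ g₁ ⊖ b ⊛ g₂) ⊘ g₁       ≈⟨ ⊖-⊘ a (b ⊛ g₂) g₁ g₁₀ ⟨
  a ⊖ (b ⊛ g₂) ⊘ g₁            ≈⟨ +-congˡ {a} (-‿cong (⊘-⊘ b g₁ g₂ g₁₀ g₂₀)) ⟨
  a ⊖ b ⊘ (g₁ ⊘ g₂)            ∎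
  where open ≈-Reasoning setoid

ratios-riccati : ∀ {Γ : ℕ → Series} → (∀ k → ConstOne (Γ k)) → (∀ k → Γ k ≈ A (suc k) ⊛ Γ (suc k) ⊖ B (suc k) ⊛ Γ (suc (suc k)))
               → Riccati (λ k → Γ k ⊘ Γ (suc k))
ratios-riccati {Γ} Γ₀ step k = ratio-step (A (suc k)) (B (suc k)) (Γ (suc k)) (Γ (suc (suc k))) (Γ₀ (suc k)) (Γ₀ (suc (suc k))) (step k)

quotients-riccati : ∀ {D E : ℕ → Series} → (∀ k → ConstOne (D k)) → (∀ k → ConstOne (E k))
                  → (∀ k → D (suc (suc k)) ≈ A (suc k) ⊛ E (suc k))
                  → (∀ k → Q ^s suc k ⊛ X ⊛ E (suc k) ≈ D (suc k) ⊖ D k)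
                  → Riccati (λ k → D (suc k) ⊘ E (suc k))
quotients-riccati {D} {E} D₀ E₀ D≈AE qXE≈ΔD k = begin
  D₁ ⊘ E₁                    ≈⟨ ⊘-cancelˡ a D₁ E₁ (constOne-A (suc k)) (E₀ (suc k)) ⟨
  (a ⊛ D₁) ⊘ (a ⊛ E₁)        ≈⟨ *-congˡ {a ⊛ D₁} (inv-cong (D≈AE k)) ⟨
  (a ⊛ D₁) ⊘ D₂              ≈⟨ ratio-step a (B (suc k)) D₂ E₂ (D₀ (suc (suc k))) (E₀ (suc (suc k))) numerator ⟩
  a ⊖ B (suc k) ⊘ (D₂ ⊘ E₂)  ∎
  where
  open ≈-Reasoning setoid
  a  = A (suc k)
  q  = Q ^s suc (suc k)
  D₁ = D (suc k)
  D₂ = D (suc (suc k))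
  E₁ = E (suc k)
  E₂ = E (suc (suc k))
  numerator : a ⊛ D₁ ≈ a ⊛ D₂ ⊖ B (suc k) ⊛ E₂
  numerator = begin
    a ⊛ D₁                   ≈⟨ solve 3 (λ a d₁ d₂ → a :* d₁ := a :* d₂ :- a :* (d₂ :- d₁)) ≈-refl a D₁ D₂ ⟩
    a ⊛ D₂ ⊖ a ⊛ (D₂ ⊖ D₁)   ≈⟨ +-congˡ {a ⊛ D₂} (-‿cong (*-congˡ {a} (qXE≈ΔD (suc k)))) ⟨
    a ⊛ D₂ ⊖ a ⊛ (q ⊛ X ⊛ E₂) ≈⟨ +-congˡ {a ⊛ D₂} (-‿cong
                                    (solve 4 (λ a q x e → a :* (q :* x :* e) := (a :* q :* x) :* e) ≈-refl a q X E₂)) ⟩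
    a ⊛ D₂ ⊖ B (suc k) ⊛ E₂  ∎

cfValue-quotient : ∀ N D E → ConstOne N → ConstOne D → ConstOne E → (Q ⊛ X) ⊛ E ≈ D ⊖ N → cfValue (D ⊘ E) ≈ D ⊘ N
cfValue-quotient N D E N₀ D₀ E₀ qxE≈D-N = begin
  1s ⊘ (1s ⊖ (Q ⊛ X) ⊘ (D ⊘ E))   ≈⟨ *-congˡ {1s} (inv-cong denominator) ⟩
  1s ⊘ (N ⊘ D)                    ≈⟨ ⊘-⊘ 1s N D N₀ D₀ ⟩
  (1s ⊛ D) ⊘ N                    ≈⟨ *-congʳ {inv N} (*-identityˡ D) ⟩
  D ⊘ N                           ∎
  where
  open ≈-Reasoning setoid
  denominator : 1s ⊖ (Q ⊛ X) ⊘ (D ⊘ E) ≈ N ⊘ D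
  denominator = begin
    1s ⊖ (Q ⊛ X) ⊘ (D ⊘ E)        ≈⟨ +-congˡ {1s} (-‿cong (⊘-⊘ (Q ⊛ X) D E D₀ E₀)) ⟩
    1s ⊖ ((Q ⊛ X) ⊛ E) ⊘ D        ≈⟨ ⊖-⊘ 1s ((Q ⊛ X) ⊛ E) D D₀ ⟩
    (1s ⊛ D ⊖ (Q ⊛ X) ⊛ E) ⊘ D    ≈⟨ *-congʳ {inv D} (+-congˡ {1s ⊛ D} (-‿cong qxE≈D-N)) ⟩
    (1s ⊛ D ⊖ (D ⊖ N)) ⊘ D        ≈⟨ *-congʳ {inv D} (solve 2 (λ d n → con (+ 1) :* d :- (d :- n) := n) ≈-refl D N) ⟩
    N ⊘ D                         ∎


record QOnly (f : Series) : Set where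
  constructor qOnly
  field x-free : ∀ n m → f (suc n) m ≡ + 0
open QOnly

-- The series Σₙ (r n) xⁿ for series r n in q alone; only the x⁰-row of each r n is read.
fromRows : (ℕ → Series) → Series
fromRows r n m = r n 0 m

qOnly-coeff : ∀ {f} → QOnly f → ∀ n m → f n m ≡ ℤ⟦q⟧⟦x⟧.ι (f 0) n m
qOnly-coeff f-q zero    m = refl
qOnly-coeff f-q (suc n) m = x-free f-q n m

qOnly⊛-coeff : ∀ {f} → QOnly f → ∀ g n m → (f ⊛ g) n m ≡ (f 0 ℤ⟦q⟧.⊠ g n) m
qOnly⊛-coeff {f} f-q g n m = ≡.trans (⊛-coeffˡ (qOnly-coeff f-q) g n m) (ℤ⟦q⟧⟦x⟧.ι-⊠ (f 0) g n m)

qOnly⊛-fromRows : ∀ {f} → QOnly f → ∀ r n m → (f ⊛ fromRows r) n m ≡ (f ⊛ r n) 0 m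
qOnly⊛-fromRows {f} f-q r n m = ≡.trans (qOnly⊛-coeff f-q (fromRows r) n m) (≡.sym (⊛-coeff f (r n) 0 m))

qOnly-1s : QOnly 1s
qOnly-1s = qOnly λ n m → refl

qOnly-Q : QOnly Q
qOnly-Q = qOnly λ n m → refl

qOnly-⊕ : ∀ {f g} → QOnly f → QOnly g → QOnly (f ⊕ g)
qOnly-⊕ f-q g-q = qOnly λ n m → cong₂ ℤ._+_ (x-free f-q n m) (x-free g-q n m)

qOnly-⊖ : ∀ {f g} → QOnly f → QOnly g → QOnly (f ⊖ g)
qOnly-⊖ f-q g-q = qOnly λ n m → cong₂ ℤ._+_ (x-free f-q n m) (cong ℤ.-_ (x-free g-q n m))

qOnly-· : ∀ c {f} → QOnly f → QOnly (c · f)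
qOnly-· c f-q = qOnly λ n m → ≡.trans (cong (c ℤ.*_) (x-free f-q n m)) (ℤ.*-zeroʳ c)

qOnly-⊛ : ∀ {f g} → QOnly f → QOnly g → QOnly (f ⊛ g)
qOnly-⊛ {f} {g} f-q g-q = qOnly λ n m → begin
  (f ⊛ g) (suc n) m                ≡⟨ qOnly⊛-coeff f-q g (suc n) m ⟩
  (f 0 ℤ⟦q⟧.⊠ g (suc n)) m         ≡⟨ ℤ⟦q⟧.⊠-cong {f 0} (λ _ → refl) (x-free g-q n) m ⟩
  (f 0 ℤ⟦q⟧.⊠ ℤ⟦q⟧.𝟘) m            ≡⟨ CommutativeRing.zeroʳ ℤ⟦q⟧.commutativeRing (f 0) m ⟩
  + 0                              ∎
  where open ≡.≡-Reasoning

qOnly-^s : ∀ {f} k → QOnly f → QOnly (f ^s k)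
qOnly-^s zero    f-q = qOnly-1s
qOnly-^s (suc k) f-q = qOnly-⊛ f-q (qOnly-^s k f-q)

qOnly-inv : ∀ {f} → QOnly f → QOnly (inv f)
qOnly-inv f-q = qOnly λ n m → ∑≤-zero (suc n ℕ.+ m) λ k _ → x-free (qOnly-^s k (qOnly-⊖ qOnly-1s f-q)) n m

qOnly-⊘ : ∀ {f g} → QOnly f → QOnly g → QOnly (f ⊘ g)
qOnly-⊘ f-q g-q = qOnly-⊛ f-q (qOnly-inv g-q)

qOnly-∏₁ : ∀ k {F} → (∀ i → QOnly (F i)) → QOnly (∏₁ k F)
qOnly-∏₁ zero    F-q = qOnly-1s
qOnly-∏₁ (suc k) F-q = qOnly-⊛ (qOnly-∏₁ k F-q) (F-q (suc k))

∑₁-cong : ∀ n {f g : ℕ → ℤ} → (∀ j → f j ≡ g j) → ∑₁ n f ≡ ∑₁ n g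
∑₁-cong zero    f≡g = refl
∑₁-cong (suc n) f≡g = cong₂ ℤ._+_ (∑₁-cong n f≡g) (f≡g (suc n))

∑₁-zero : ∀ n {f : ℕ → ℤ} → (∀ j → 1 ≤ j → j ≤ n → f j ≡ + 0) → ∑₁ n f ≡ + 0
∑₁-zero zero    f≡0 = refl
∑₁-zero (suc n) f≡0 =
  cong₂ ℤ._+_ (∑₁-zero n λ j 1≤j j≤n → f≡0 j 1≤j (ℕ.m≤n⇒m≤1+n j≤n)) (f≡0 (suc n) (s≤s z≤n) ℕ.≤-refl)

∑x-cong : ∀ {t u : ℕ → Series} → (∀ j → t j ≈ u j) → ∑x t ≈ ∑x u
∑x-cong t≈u = mk≈ λ n m → ∑₁-cong n λ j → at (t≈u j) n m

∑x-X^⊛-suc : ∀ {F : ℕ → Series} → (∀ j → QOnly (F j)) → ∀ n m → ∑x (λ j → X ^s j ⊛ F j) (suc n) m ≡ F (suc n) 0 m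
∑x-X^⊛-suc {F} F-q n m = begin
  ∑₁ n (λ j → (X ^s j ⊛ F j) (suc n) m) ℤ.+ (X ^s suc n ⊛ F (suc n)) (suc n) m
                                          ≡⟨ cong₂ ℤ._+_ (∑₁-zero n below) (X^⊛-coeff-≥ (suc n) (F (suc n)) m ℕ.≤-refl) ⟩
  + 0 ℤ.+ F (suc n) (n ∸ n) m             ≡⟨ ℤ.+-identityˡ _ ⟩
  F (suc n) (n ∸ n) m                     ≡⟨ cong (λ i → F (suc n) i m) (ℕ.n∸n≡0 n) ⟩
  F (suc n) 0 m                           ∎
  where
  open ≡.≡-Reasoning
  below : ∀ j → 1 ≤ j → j ≤ n → (X ^s j ⊛ F j) (suc n) m ≡ + 0
  below j _ j≤n = ≡.trans (X^⊛-coeff-≥ j (F j) m (ℕ.m≤n⇒m≤1+n j≤n))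
    (≡.trans (cong (λ i → F j i m) (ℕ.+-∸-assoc 1 j≤n)) (x-free (F-q j) (n ∸ j) m))


-- An explicit solution of the continued-fraction recursion

constOne-1⊖Q^suc : ∀ j → ConstOne (1s ⊖ Q ^s suc j)
constOne-1⊖Q^suc j = cong (λ z → + 1 ℤ.+ ℤ.- z) (ℤ.*-zeroˡ ((Q ^s j) 0 0))

factor : ℕ → Series
factor i = (1s ⊖ Q ^s i ⊕ Q ^s (2 ℕ.* i)) ⊘ (1s ⊖ Q ^s i)

α : ℕ → Series
α j = sgn j · P j

γ : ℕ → Series
γ j = sgn j · (((Q ^s j) ⊘ (1s ⊖ Q ^s j)) ⊛ P j)

qOnly-factor : ∀ i → QOnly (factor i)
qOnly-factor i = qOnly-⊘ (qOnly-⊕ (qOnly-⊖ qOnly-1s (qOnly-^s i qOnly-Q)) (qOnly-^s (2 ℕ.* i) qOnly-Q)) (qOnly-⊖ qOnly-1s (qOnly-^s i qOnly-Q))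

qOnly-P : ∀ j → QOnly (P j)
qOnly-P j = qOnly-∏₁ (j ∸ 1) qOnly-factor

qOnly-α : ∀ j → QOnly (α j)
qOnly-α j = qOnly-· (sgn j) (qOnly-P j)

qOnly-γ : ∀ j → QOnly (γ j)
qOnly-γ j = qOnly-· (sgn j) (qOnly-⊛ (qOnly-⊘ (qOnly-^s j qOnly-Q) (qOnly-⊖ qOnly-1s (qOnly-^s j qOnly-Q))) (qOnly-P j))

α+α≈-qγ : ∀ j → α (suc (suc j)) ⊕ α (suc j) ≈ neg (Q ^s suc j ⊛ γ (suc j))
α+α≈-qγ j = cancel-inverse (1s ⊖ W) (S ⊛ Pⱼ) (constOne-1⊖Q^suc j) (begin
  α (suc (suc j)) ⊕ α (suc j)                          ≈⟨ +-cong (≈-trans (neg-· s (Pⱼ ⊛ factor (suc j))) (-‿cong (·-as-⊛ s (Pⱼ ⊛ factor (suc j))))) (·-as-⊛ s Pⱼ) ⟩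
  neg (S ⊛ (Pⱼ ⊛ ((1s ⊖ W ⊕ Q ^s (2 ℕ.* suc j)) ⊛ u))) ⊕ S ⊛ Pⱼ
                                                       ≈⟨ +-congʳ (-‿cong (*-congˡ {S} (*-congˡ {Pⱼ} (*-congʳ {u} (+-congˡ {1s ⊖ W} W²≈W⊛W))))) ⟩
  neg (S ⊛ (Pⱼ ⊛ ((1s ⊖ W ⊕ W ⊛ W) ⊛ u))) ⊕ S ⊛ Pⱼ      ≈⟨ solve 4 (λ S P W u →
                                                              :- (S :* (P :* ((con (+ 1) :- W :+ W :* W) :* u))) :+ S :* P
                                                           := :- (W :* (S :* ((W :* u) :* P))) :+ S :* P :* (con (+ 1) :- (con (+ 1) :- W) :* u))
                                                           ≈-refl S Pⱼ W u ⟩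
  neg (W ⊛ (S ⊛ ((W ⊛ u) ⊛ Pⱼ))) ⊕ S ⊛ Pⱼ ⊛ (1s ⊖ (1s ⊖ W) ⊛ u)
                                                       ≈⟨ +-congʳ (-‿cong (*-congˡ {W} (·-as-⊛ s ((W ⊛ u) ⊛ Pⱼ)))) ⟨
  neg (W ⊛ γ (suc j)) ⊕ S ⊛ Pⱼ ⊛ (1s ⊖ (1s ⊖ W) ⊛ u)    ∎)
  where
  open ≈-Reasoning setoid
  s  = sgn (suc j)
  S  = s · 1s
  W  = Q ^s suc j
  u  = inv (1s ⊖ W)
  Pⱼ = P (suc j)
  neg-· : ∀ c f → (ℤ.- c) · f ≈ neg (c · f)
  neg-· c f = mk≈ λ n m → ≡.sym (ℤ.neg-distribˡ-* c (f n m))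
  W²≈W⊛W : Q ^s (2 ℕ.* suc j) ≈ W ⊛ W
  W²≈W⊛W = ≈-trans (≈-reflexive (cong (λ i → Q ^s (suc j ℕ.+ i)) (ℕ.+-identityʳ (suc j)))) (^s-+ Q (suc j) (suc j))

qα≈γ-qγ : ∀ j → Q ^s suc j ⊛ α (suc j) ≈ γ (suc j) ⊖ Q ^s suc j ⊛ γ (suc j)
qα≈γ-qγ j = ≈-sym (cancel-inverse (1s ⊖ W) (neg (S ⊛ W ⊛ Pⱼ)) (constOne-1⊖Q^suc j) (begin
  γ (suc j) ⊖ W ⊛ γ (suc j)                         ≈⟨ +-cong (·-as-⊛ s ((W ⊛ u) ⊛ Pⱼ)) (-‿cong (*-congˡ {W} (·-as-⊛ s ((W ⊛ u) ⊛ Pⱼ)))) ⟩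
  S ⊛ ((W ⊛ u) ⊛ Pⱼ) ⊖ W ⊛ (S ⊛ ((W ⊛ u) ⊛ Pⱼ))     ≈⟨ solve 4 (λ S P W u →
                                                           S :* ((W :* u) :* P) :- W :* (S :* ((W :* u) :* P))
                                                        := W :* (S :* P) :+ (:- (S :* W :* P)) :* (con (+ 1) :- (con (+ 1) :- W) :* u))
                                                        ≈-refl S Pⱼ W u ⟩
  W ⊛ (S ⊛ Pⱼ) ⊕ neg (S ⊛ W ⊛ Pⱼ) ⊛ (1s ⊖ (1s ⊖ W) ⊛ u)
                                                     ≈⟨ +-congʳ (*-congˡ {W} (·-as-⊛ s Pⱼ)) ⟨
  W ⊛ α (suc j) ⊕ neg (S ⊛ W ⊛ Pⱼ) ⊛ (1s ⊖ (1s ⊖ W) ⊛ u) ∎))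
  where
  open ≈-Reasoning setoid
  s  = sgn (suc j)
  S  = s · 1s
  W  = Q ^s suc j
  u  = inv (1s ⊖ W)
  Pⱼ = P (suc j)

δ : ℕ → ℕ → Series
δ k zero    = 1s
δ k (suc n) = neg (Q ^s (k ℕ.* suc n) ⊛ γ (suc n))

ε : ℕ → ℕ → Series
ε k n = Q ^s (k ℕ.* n) ⊛ α (suc n)

D : ℕ → Series
D k = fromRows (δ k)

E : ℕ → Series
E k = fromRows (ε k)

Q^-*-suc : ∀ k n → Q ^s (k ℕ.* suc n) ≈ Q ^s k ⊛ Q ^s (k ℕ.* n)
Q^-*-suc k n = ≈-trans (≈-reflexive (cong (Q ^s_) (ℕ.*-suc k n))) (^s-+ Q k (k ℕ.* n))

δ-step : ∀ k n → δ (suc (suc k)) (suc n) ≈ ε (suc k) (suc n) ⊕ Q ^s suc k ⊛ ε (suc k) n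
δ-step k n = begin
  neg (Q ^s (suc n ℕ.+ suc k ℕ.* suc n) ⊛ γ′)   ≈⟨ -‿cong (*-congʳ {γ′} (^s-+ Q (suc n) (suc k ℕ.* suc n))) ⟩
  neg ((W ⊛ V) ⊛ γ′)                           ≈⟨ solve 3 (λ W V c → :- ((W :* V) :* c) := V :* (:- (W :* c))) ≈-refl W V γ′ ⟩
  V ⊛ neg (W ⊛ γ′)                             ≈⟨ *-congˡ {V} (α+α≈-qγ n) ⟨
  V ⊛ (α (suc (suc n)) ⊕ α (suc n))            ≈⟨ distribˡ V (α (suc (suc n))) (α (suc n)) ⟩
  V ⊛ α (suc (suc n)) ⊕ V ⊛ α (suc n)          ≈⟨ +-congˡ {V ⊛ α (suc (suc n))} (*-congʳ {α (suc n)} (Q^-*-suc (suc k) n)) ⟩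
  V ⊛ α (suc (suc n)) ⊕ (Q ^s suc k ⊛ Q ^s (suc k ℕ.* n)) ⊛ α (suc n)
                                               ≈⟨ +-congˡ {V ⊛ α (suc (suc n))} (*-assoc (Q ^s suc k) (Q ^s (suc k ℕ.* n)) (α (suc n))) ⟩
  ε (suc k) (suc n) ⊕ Q ^s suc k ⊛ ε (suc k) n ∎
  where
  open ≈-Reasoning setoid
  γ′ = γ (suc n)
  W  = Q ^s suc n
  V  = Q ^s (suc k ℕ.* suc n)

δ-difference : ∀ k n → Q ^s suc k ⊛ ε (suc k) n ≈ δ (suc k) (suc n) ⊖ δ k (suc n)
δ-difference k n = begin
  Q ^s suc k ⊛ (Q ^s (suc k ℕ.* n) ⊛ α′)      ≈⟨ *-assoc (Q ^s suc k) (Q ^s (suc k ℕ.* n)) α′ ⟨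
  (Q ^s suc k ⊛ Q ^s (suc k ℕ.* n)) ⊛ α′      ≈⟨ *-congʳ {α′} (Q^-*-suc (suc k) n) ⟨
  Q ^s (suc n ℕ.+ k ℕ.* suc n) ⊛ α′           ≈⟨ *-congʳ {α′} (^s-+ Q (suc n) (k ℕ.* suc n)) ⟩
  (W ⊛ V) ⊛ α′                                ≈⟨ solve 3 (λ W V a → (W :* V) :* a := V :* (W :* a)) ≈-refl W V α′ ⟩
  V ⊛ (W ⊛ α′)                                ≈⟨ *-congˡ {V} (qα≈γ-qγ n) ⟩
  V ⊛ (γ′ ⊖ W ⊛ γ′)                           ≈⟨ solve 3 (λ W V c → V :* (c :- W :* c) := :- ((W :* V) :* c) :- (:- (V :* c))) ≈-refl W V γ′ ⟩
  neg ((W ⊛ V) ⊛ γ′) ⊖ neg (V ⊛ γ′)           ≈⟨ +-congʳ (-‿cong (*-congʳ {γ′} (^s-+ Q (suc n) (k ℕ.* suc n)))) ⟨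
  δ (suc k) (suc n) ⊖ δ k (suc n)             ∎
  where
  open ≈-Reasoning setoid
  α′ = α (suc n)
  γ′ = γ (suc n)
  W  = Q ^s suc n
  V  = Q ^s (k ℕ.* suc n)

ε-zero : ∀ k → ε k 0 ≈ 1s
ε-zero k = begin
  Q ^s (k ℕ.* 0) ⊛ α 1   ≈⟨ *-congʳ {α 1} (≈-reflexive (cong (Q ^s_) (ℕ.*-zeroʳ k))) ⟩
  1s ⊛ α 1               ≈⟨ *-identityˡ (α 1) ⟩
  α 1                    ≈⟨ mk≈ (λ n m → ℤ.*-identityˡ (1s n m)) ⟩
  1s                     ∎
  where open ≈-Reasoning setoid

constOne-D : ∀ k → ConstOne (D k)
constOne-D k = refl

constOne-E : ∀ k → ConstOne (E k)
constOne-E k = at (ε-zero k) 0 0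

D≈AE : ∀ k → D (suc (suc k)) ≈ A (suc k) ⊛ E (suc k)
D≈AE k = ≈-sym (≈-trans (solve 3 (λ q x e → (con (+ 1) :+ q :* x) :* e := e :+ x :* (q :* e)) ≈-refl (Q ^s suc k) X E′) (mk≈ coeff))
  where
  E′ = E (suc k)
  coeff : ∀ n m → (E′ ⊕ X ⊛ (Q ^s suc k ⊛ E′)) n m ≡ D (suc (suc k)) n m
  coeff zero    m = ≡.trans (cong₂ ℤ._+_ (at (ε-zero (suc k)) 0 m) (X⊛-coeff-zero (Q ^s suc k ⊛ E′) m)) (ℤ.+-identityʳ (1s 0 m))
  coeff (suc n) m = ≡.trans (cong (ℤ._+_ (ε (suc k) (suc n) 0 m))
                      (≡.trans (X⊛-coeff-suc (Q ^s suc k ⊛ E′) n m) (qOnly⊛-fromRows (qOnly-^s (suc k) qOnly-Q) (ε (suc k)) n m)))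
                      (≡.sym (at (δ-step k n) 0 m))

qXE≈ΔD : ∀ k → Q ^s suc k ⊛ X ⊛ E (suc k) ≈ D (suc k) ⊖ D k
qXE≈ΔD k = ≈-trans (solve 3 (λ q x e → q :* x :* e := x :* (q :* e)) ≈-refl (Q ^s suc k) X E′) (mk≈ coeff)
  where
  E′ = E (suc k)
  coeff : ∀ n m → (X ⊛ (Q ^s suc k ⊛ E′)) n m ≡ (D (suc k) ⊖ D k) n m
  coeff zero    m = ≡.trans (X⊛-coeff-zero (Q ^s suc k ⊛ E′) m) (≡.sym (ℤ.+-inverseʳ (1s 0 m)))
  coeff (suc n) m = ≡.trans (X⊛-coeff-suc (Q ^s suc k ⊛ E′) n m)
                      (≡.trans (qOnly⊛-fromRows (qOnly-^s (suc k) qOnly-Q) (ε (suc k)) n m) (at (δ-difference k n) 0 m))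

qXE₁≈D₁-D₀ : (Q ⊛ X) ⊛ E 1 ≈ D 1 ⊖ D 0
qXE₁≈D₁-D₀ = ≈-trans (*-congʳ {E 1} (*-congʳ {X} (≈-sym (*-identityʳ Q)))) (qXE≈ΔD 0)

D⊘E-riccati : Riccati (λ k → D (suc k) ⊘ E (suc k))
D⊘E-riccati = quotients-riccati {D} {E} constOne-D constOne-E D≈AE qXE≈ΔD

Den≈D0 : Den ≈ D 0
Den≈D0 = mk≈ coeff
  where
  t : ℕ → Series
  t j = sgn j · (((Q ^s j ⊛ X ^s j) ⊘ (1s ⊖ Q ^s j)) ⊛ P j)
  term≈ : ∀ j → t j ≈ X ^s j ⊛ γ j
  term≈ j = begin
    t j                                                     ≈⟨ ·-as-⊛ (sgn j) (((Q ^s j ⊛ X ^s j) ⊛ u) ⊛ P j) ⟩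
    S ⊛ (((Q ^s j ⊛ X ^s j) ⊛ u) ⊛ P j)                    ≈⟨ solve 5 (λ S q x u p → S :* (((q :* x) :* u) :* p) := x :* (S :* ((q :* u) :* p))) ≈-refl S (Q ^s j) (X ^s j) u (P j) ⟩
    X ^s j ⊛ (S ⊛ ((Q ^s j ⊛ u) ⊛ P j))                    ≈⟨ *-congˡ {X ^s j} (·-as-⊛ (sgn j) ((Q ^s j ⊛ u) ⊛ P j)) ⟨
    X ^s j ⊛ γ j                                            ∎
    where
    open ≈-Reasoning setoid
    S = sgn j · 1s
    u = inv (1s ⊖ Q ^s j)
  coeff : ∀ n m → Den n m ≡ D 0 n m
  coeff zero    m = ℤ.+-identityʳ (1s 0 m)
  coeff (suc n) m = begin
    + 0 ℤ.+ ℤ.- ∑x t (suc n) m                       ≡⟨ ℤ.+-identityˡ _ ⟩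
    ℤ.- ∑x t (suc n) m                               ≡⟨ cong ℤ.-_ (at (∑x-cong term≈) (suc n) m) ⟩
    ℤ.- ∑x (λ j → X ^s j ⊛ γ j) (suc n) m            ≡⟨ cong ℤ.-_ (∑x-X^⊛-suc qOnly-γ n m) ⟩
    ℤ.- γ (suc n) 0 m                                ≡⟨ cong ℤ.-_ (at (*-identityˡ (γ (suc n))) 0 m) ⟨
    D 0 (suc n) m                                  ∎
    where open ≡.≡-Reasoning

Num≈D1-D0 : Num ≈ D 1 ⊖ D 0
Num≈D1-D0 = mk≈ coeff
  where
  t : ℕ → Series
  t j = sgn j · (Q ^s j ⊛ X ^s j ⊛ P j)
  term≈ : ∀ j → t j ≈ X ^s j ⊛ (Q ^s j ⊛ α j)
  term≈ j = begin
    t j                                    ≈⟨ ·-as-⊛ (sgn j) (Q ^s j ⊛ X ^s j ⊛ P j) ⟩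
    S ⊛ (Q ^s j ⊛ X ^s j ⊛ P j)            ≈⟨ solve 4 (λ S q x p → S :* (q :* x :* p) := x :* (q :* (S :* p))) ≈-refl S (Q ^s j) (X ^s j) (P j) ⟩
    X ^s j ⊛ (Q ^s j ⊛ (S ⊛ P j))          ≈⟨ *-congˡ {X ^s j} (*-congˡ {Q ^s j} (·-as-⊛ (sgn j) (P j))) ⟨
    X ^s j ⊛ (Q ^s j ⊛ α j)                ∎
    where
    open ≈-Reasoning setoid
    S = sgn j · 1s
  Q^suc≈Q⊛Q^ : ∀ n → Q ^s suc n ≈ Q ^s 1 ⊛ Q ^s (1 ℕ.* n)
  Q^suc≈Q⊛Q^ n = ≈-trans (≈-reflexive (cong (Q ^s_) (≡.sym (ℕ.*-identityˡ (suc n))))) (Q^-*-suc 1 n)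
  coeff : ∀ n m → Num n m ≡ (D 1 ⊖ D 0) n m
  coeff zero    m = ≡.sym (ℤ.+-inverseʳ (1s 0 m))
  coeff (suc n) m = begin
    ∑x t (suc n) m                                      ≡⟨ at (∑x-cong term≈) (suc n) m ⟩
    ∑x (λ j → X ^s j ⊛ (Q ^s j ⊛ α j)) (suc n) m        ≡⟨ ∑x-X^⊛-suc (λ j → qOnly-⊛ (qOnly-^s j qOnly-Q) (qOnly-α j)) n m ⟩
    (Q ^s suc n ⊛ α (suc n)) 0 m                        ≡⟨ at (*-congʳ {α (suc n)} (Q^suc≈Q⊛Q^ n)) 0 m ⟩
    ((Q ^s 1 ⊛ Q ^s (1 ℕ.* n)) ⊛ α (suc n)) 0 m         ≡⟨ at (*-assoc (Q ^s 1) (Q ^s (1 ℕ.* n)) (α (suc n))) 0 m ⟩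
    (Q ^s 1 ⊛ ε 1 n) 0 m                                ≡⟨ at (δ-difference 0 n) 0 m ⟩
    (D 1 ⊖ D 0) (suc n) m                               ∎
    where open ≡.≡-Reasoning


-- Counting the words of 𝓑 with an automaton

count : ∀ {C : Set} → (C → Bool) → List C → ℕ
count φ []       = 0
count φ (x ∷ xs) = if φ x then suc (count φ xs) else count φ xs

length-filterᵇ : ∀ {C : Set} (φ : C → Bool) xs → length (filterᵇ φ xs) ≡ count φ xs
length-filterᵇ φ []       = refl
length-filterᵇ φ (x ∷ xs) with φ x
... | true  = cong suc (length-filterᵇ φ xs)
... | false = length-filterᵇ φ xs

count-++ : ∀ {C : Set} (φ : C → Bool) xs ys → count φ (xs ++ ys) ≡ count φ xs ℕ.+ count φ ys
count-++ φ []       ys = refl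
count-++ φ (x ∷ xs) ys with φ x
... | true  = cong suc (count-++ φ xs ys)
... | false = count-++ φ xs ys

count-map : ∀ {C C′ : Set} (φ : C′ → Bool) (f : C → C′) xs → count φ (map f xs) ≡ count (φ ∘ f) xs
count-map φ f []       = refl
count-map φ f (x ∷ xs) with φ (f x)
... | true  = cong suc (count-map φ f xs)
... | false = count-map φ f xs

count-cong : ∀ {C : Set} {φ ψ : C → Bool} → (∀ x → φ x ≡ ψ x) → ∀ xs → count φ xs ≡ count ψ xs
count-cong φ≡ψ []       = refl
count-cong {ψ = ψ} φ≡ψ (x ∷ xs) rewrite φ≡ψ x = cong (λ c → if ψ x then suc c else c) (count-cong φ≡ψ xs)

count-false : ∀ {C : Set} (xs : List C) → count (λ _ → false) xs ≡ 0
count-false []       = refl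
count-false (x ∷ xs) = count-false xs

∑< : ℕ → (ℕ → ℕ) → ℕ
∑< zero    h = 0
∑< (suc K) h = h 0 ℕ.+ ∑< K (h ∘ suc)

∑<-cong : ∀ K {h h′ : ℕ → ℕ} → (∀ a → a < K → h a ≡ h′ a) → ∑< K h ≡ ∑< K h′
∑<-cong zero    h≡h′ = refl
∑<-cong (suc K) h≡h′ = cong₂ ℕ._+_ (h≡h′ 0 (s≤s z≤n)) (∑<-cong K λ a a<K → h≡h′ (suc a) (s≤s a<K))

∑<-zero : ∀ K (h : ℕ → ℕ) → (∀ a → a < K → h a ≡ 0) → ∑< K h ≡ 0
∑<-zero zero    h h≡0 = refl
∑<-zero (suc K) h h≡0 = cong₂ ℕ._+_ (h≡0 0 (s≤s z≤n)) (∑<-zero K (h ∘ suc) λ a a<K → h≡0 (suc a) (s≤s a<K))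

∑<-extend : ∀ N K (h : ℕ → ℕ) → N ≤ K → (∀ a → N ≤ a → h a ≡ 0) → ∑< K h ≡ ∑< N h
∑<-extend zero    zero    h _         h≡0 = refl
∑<-extend zero    (suc K) h _         h≡0 = cong₂ ℕ._+_ (h≡0 0 z≤n) (∑<-extend 0 K (h ∘ suc) z≤n λ a _ → h≡0 (suc a) z≤n)
∑<-extend (suc N) (suc K) h (s≤s N≤K) h≡0 = cong (h 0 ℕ.+_) (∑<-extend N K (h ∘ suc) N≤K λ a N≤a → h≡0 (suc a) (s≤s N≤a))

∑<-suc : ∀ K (h : ℕ → ℕ) → ∑< (suc K) h ≡ ∑< K h ℕ.+ h K
∑<-suc zero    h = ℕ.+-comm (h 0) 0
∑<-suc (suc K) h = ≡.trans (cong (h 0 ℕ.+_) (∑<-suc K (h ∘ suc))) (≡.sym (ℕ.+-assoc (h 0) _ _))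

∑<-∑≤ : ∀ N (h : ℕ → ℕ) → + ∑< (suc N) h ≡ ∑≤ N (λ b → + h b)
∑<-∑≤ zero    h = cong +_ (ℕ.+-identityʳ (h 0))
∑<-∑≤ (suc N) h = begin
  + ∑< (suc (suc N)) h                  ≡⟨ cong +_ (∑<-suc (suc N) h) ⟩
  + (∑< (suc N) h ℕ.+ h (suc N))        ≡⟨ ℤ.pos-+ (∑< (suc N) h) (h (suc N)) ⟩
  + ∑< (suc N) h ℤ.+ + h (suc N)        ≡⟨ cong (ℤ._+ + h (suc N)) (∑<-∑≤ N h) ⟩
  ∑≤ (suc N) (λ b → + h b)              ∎
  where open ≡.≡-Reasoning

count-concat-applyUpTo : ∀ {C : Set} (φ : C → Bool) (g : ℕ → List C) (f : ℕ → ℕ) K →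
                         count φ (concat (map g (applyUpTo f K))) ≡ ∑< K (count φ ∘ g ∘ f)
count-concat-applyUpTo φ g f zero    = refl
count-concat-applyUpTo φ g f (suc K) =
  ≡.trans (count-++ φ (g (f 0)) _) (cong (count φ (g (f 0)) ℕ.+_) (count-concat-applyUpTo φ g (f ∘ suc) K))

count-allWords : ∀ (φ : List ℕ → Bool) n K →
                 count φ (allWords (suc n) K) ≡ ∑< K (λ a → count (φ ∘ (a ∷_)) (allWords n K))
count-allWords φ n K = ≡.trans (count-concat-applyUpTo φ (λ a → map (a ∷_) (allWords n K)) id K)
  (∑<-cong K λ a _ → count-map φ (a ∷_) (allWords n K))

≤⇒≤ᵇ≡true : ∀ {m n} → m ≤ n → (m ≤ᵇ n) ≡ true
≤⇒≤ᵇ≡true m≤n = Equivalence.to T-≡ (ℕ.≤⇒≤ᵇ m≤n)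

>⇒≤ᵇ≡false : ∀ {m n} → n < m → (m ≤ᵇ n) ≡ false
>⇒≤ᵇ≡false {m} {n} n<m with m ≤ᵇ n in m≤ᵇn
... | false = refl
... | true  = ⊥-elim (ℕ.<⇒≱ n<m (ℕ.≤ᵇ⇒≤ m n (Equivalence.from T-≡ m≤ᵇn)))

suc≤ᵇsuc : ∀ c m → (suc c ≤ᵇ suc m) ≡ (c ≤ᵇ m)
suc≤ᵇsuc zero    m = refl
suc≤ᵇsuc (suc c) m = refl

+-≡ᵇ : ∀ c a m → (c ℕ.+ a ≡ᵇ m) ≡ (if c ≤ᵇ m then a ≡ᵇ m ∸ c else false)
+-≡ᵇ zero    a m       = refl
+-≡ᵇ (suc c) a zero    = refl
+-≡ᵇ (suc c) a (suc m) rewrite suc≤ᵇsuc c m = +-≡ᵇ c a m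

count-+-≡ᵇ : ∀ {C : Set} (φ : C → Bool) (f : C → ℕ) c m xs →
             count (λ x → φ x ∧ (c ℕ.+ f x ≡ᵇ m)) xs ≡ (if c ≤ᵇ m then count (λ x → φ x ∧ (f x ≡ᵇ m ∸ c)) xs else 0)
count-+-≡ᵇ φ f c m xs with c ≤ᵇ m in c≤ᵇm
... | true  = count-cong (λ x → cong (φ x ∧_) (≡.trans (+-≡ᵇ c (f x) m) (cong (if_then f x ≡ᵇ m ∸ c else false) c≤ᵇm))) xs
... | false = ≡.trans (count-cong (λ x → ≡.trans (cong (φ x ∧_) (≡.trans (+-≡ᵇ c (f x) m) (cong (if_then f x ≡ᵇ m ∸ c else false) c≤ᵇm)))
                                                 (∧-zeroʳ (φ x))) xs)
                      (count-false xs)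

-- State (p , d) after a letter p: d says that the two last letters a p satisfy a ≥ p, so that
-- by (≥,≥)-avoidance the next letter must exceed p, and the word may not end there.
accepts : ℕ → Bool → List ℕ → Bool
accepts p d []      = not d
accepts p d (b ∷ w) = (b ≤ᵇ suc p) ∧ (if b ≤ᵇ p then not d ∧ accepts b true w else accepts b false w)

accepts-after : ∀ a p w → catTail p w ∧ (avoidsGeGeᵇ (a ∷ p ∷ w) ∧ goodEndingᵇ (a ∷ p ∷ w)) ≡ accepts p (p ≤ᵇ a) w
accepts-after a p []      = refl
accepts-after a p (b ∷ w) with b ≤ᵇ suc p | p ≤ᵇ a | b ≤ᵇ p | accepts-after p b w
... | false | _     | _     | _  = refl
... | true  | true  | true  | _  = ∧-zeroʳ (catTail b w)
... | true  | false | true  | ih = ih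
... | true  | true  | false | ih = ih
... | true  | false | false | ih = ih

accepts-from : ∀ p w → catTail p w ∧ (avoidsGeGeᵇ (p ∷ w) ∧ goodEndingᵇ (p ∷ w)) ≡ accepts p false w
accepts-from p []      = refl
accepts-from p (b ∷ w) with b ≤ᵇ suc p | b ≤ᵇ p | accepts-after p b w
... | false | _     | _  = refl
... | true  | true  | ih = ih
... | true  | false | ih = ih

mutual
  walks : ℕ → ℕ → Bool → ℕ → ℕ
  walks zero    p d m = if not d ∧ (0 ≡ᵇ m) then 1 else 0
  walks (suc n) p d m = ∑< (suc (suc p)) (walksVia n p d m)

  walksVia : ℕ → ℕ → Bool → ℕ → ℕ → ℕ
  walksVia n p d m b = if b ≤ᵇ p then (if d then 0 else walksAfter n b true m) else walksAfter n b false m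

  walksAfter : ℕ → ℕ → Bool → ℕ → ℕ
  walksAfter n b d m = if suc b ≤ᵇ m then walks n b d (m ∸ suc b) else 0

mutual
  count-walks : ∀ n p d m K → p ℕ.+ n < K → count (λ w → accepts p d w ∧ (area w ≡ᵇ m)) (allWords n K) ≡ walks n p d m
  count-walks zero    p d m K _       = refl
  count-walks (suc n) p d m K p+n+1<K = begin
    count valid (allWords (suc n) K)        ≡⟨ count-allWords valid n K ⟩
    ∑< K (λ b → count (valid ∘ (b ∷_)) L)   ≡⟨ ∑<-cong K (λ b _ → first-letter b d) ⟩
    ∑< K guarded                            ≡⟨ ∑<-extend (suc (suc p)) K guarded p+2≤K
                                                 (λ b p+2≤b → cong (λ c → if c then walksVia n p d m b else 0) (>⇒≤ᵇ≡false p+2≤b)) ⟩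
    ∑< (suc (suc p)) guarded                ≡⟨ ∑<-cong (suc (suc p))
                                                 (λ b b<p+2 → cong (λ c → if c then walksVia n p d m b else 0) (≤⇒≤ᵇ≡true (ℕ.≤-pred b<p+2))) ⟩
    walks (suc n) p d m                     ∎
    where
    open ≡.≡-Reasoning
    valid : List ℕ → Bool
    valid w = accepts p d w ∧ (area w ≡ᵇ m)
    L : List (List ℕ)
    L = allWords n K
    guarded : ℕ → ℕ
    guarded b = if b ≤ᵇ suc p then walksVia n p d m b else 0
    p+2≤K : suc (suc p) ≤ K
    p+2≤K = ℕ.≤-trans (s≤s (ℕ.≤-trans (ℕ.≤-reflexive (ℕ.+-comm 1 p)) (ℕ.+-monoʳ-≤ p (s≤s z≤n)))) p+n+1<K
    after : ∀ b d′ → b ≤ suc p → count (λ w → accepts b d′ w ∧ (suc b ℕ.+ area w ≡ᵇ m)) L ≡ walksAfter n b d′ m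
    after b d′ b≤p+1 = count-walksAfter n b d′ m K
      (ℕ.≤-<-trans (ℕ.≤-trans (ℕ.+-monoˡ-≤ n b≤p+1) (ℕ.≤-reflexive (≡.sym (ℕ.+-suc p n)))) p+n+1<K)
    -- Stated with accepts p e (b ∷ w) and walksVia unfolded, so that with can abstract the tests.
    first-letter : ∀ b e → count (λ w → ((b ≤ᵇ suc p) ∧ (if b ≤ᵇ p then not e ∧ accepts b true w else accepts b false w)) ∧ (suc b ℕ.+ area w ≡ᵇ m)) L
                         ≡ (if b ≤ᵇ suc p then (if b ≤ᵇ p then (if e then 0 else walksAfter n b true m) else walksAfter n b false m) else 0)
    first-letter b e with b ≤ᵇ suc p in b≤ᵇp+1 | b ≤ᵇ p | e
    ... | false | _     | _     = count-false L
    ... | true  | true  | true  = count-false L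
    ... | true  | true  | false = after b true (ℕ.≤ᵇ⇒≤ b (suc p) (Equivalence.from T-≡ b≤ᵇp+1))
    ... | true  | false | _     = after b false (ℕ.≤ᵇ⇒≤ b (suc p) (Equivalence.from T-≡ b≤ᵇp+1))

  count-walksAfter : ∀ n b d m K → b ℕ.+ n < K →
                     count (λ w → accepts b d w ∧ (suc b ℕ.+ area w ≡ᵇ m)) (allWords n K) ≡ walksAfter n b d m
  count-walksAfter n b d m K b+n<K = ≡.trans (count-+-≡ᵇ (accepts b d) area (suc b) m (allWords n K))
    (cong (λ k → if suc b ≤ᵇ m then k else 0) (count-walks n b d (m ∸ suc b) K b+n<K))

Bser-walks : ∀ n m → length (filterᵇ (λ w → inBᵇ w ∧ (area w ≡ᵇ m)) (allWords (suc n) (suc n))) ≡ walksAfter n 0 false m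
Bser-walks n m = begin
  length (filterᵇ valid (allWords (suc n) (suc n)))                  ≡⟨ length-filterᵇ valid (allWords (suc n) (suc n)) ⟩
  count valid (allWords (suc n) (suc n))                             ≡⟨ count-allWords valid n (suc n) ⟩
  count (valid ∘ (0 ∷_)) L ℕ.+ ∑< n (λ a → count (valid ∘ (suc a ∷_)) L)
                                                                     ≡⟨ cong₂ ℕ._+_ (count-cong (λ w → cong (_∧ (1 ℕ.+ area w ≡ᵇ m)) (accepts-from 0 w)) L)
                                                                          (∑<-extend 0 n _ z≤n (λ a _ → count-false L)) ⟩
  count (λ w → accepts 0 false w ∧ (1 ℕ.+ area w ≡ᵇ m)) L ℕ.+ 0      ≡⟨ ℕ.+-identityʳ _ ⟩
  count (λ w → accepts 0 false w ∧ (1 ℕ.+ area w ≡ᵇ m)) L            ≡⟨ count-walksAfter n 0 false m (suc n) ℕ.≤-refl ⟩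
  walksAfter n 0 false m                                             ∎
  where
  open ≡.≡-Reasoning
  valid : List ℕ → Bool
  valid w = inBᵇ w ∧ (area w ≡ᵇ m)
  L : List (List ℕ)
  L = allWords n (suc n)


-- The three-term recurrence of the generating functions

G : ℕ → Series
G p n m = + walks n p false m

H : ℕ → Series
H p n m = + walks n p true m

walksAfter-series : ∀ b d n m → + walksAfter n b d m ≡ (Q ^s suc b ⊛ (λ n m → + walks n b d m)) n m
walksAfter-series b d n m = ≡.trans (if-float +_ (suc b ≤ᵇ m)) (≡.sym (Q^⊛-coeff (suc b) (λ n m → + walks n b d m) n m))

walksVia-≤ : ∀ n p d m b → b ≤ p → walksVia n p d m b ≡ (if d then 0 else walksAfter n b true m)
walksVia-≤ n p d m b b≤p =
  cong (λ c → if c then (if d then 0 else walksAfter n b true m) else walksAfter n b false m) (≤⇒≤ᵇ≡true b≤p)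

walksVia-suc : ∀ n p d m → walksVia n p d m (suc p) ≡ walksAfter n (suc p) false m
walksVia-suc n p d m =
  cong (λ c → if c then (if d then 0 else walksAfter n (suc p) true m) else walksAfter n (suc p) false m) (>⇒≤ᵇ≡false (ℕ.n<1+n p))

H≈ : ∀ p → H p ≈ X ⊛ (Q ^s suc (suc p) ⊛ G (suc p))
H≈ p = mk≈ coeff
  where
  coeff : ∀ n m → H p n m ≡ (X ⊛ (Q ^s suc (suc p) ⊛ G (suc p))) n m
  coeff zero    m = ≡.sym (X⊛-coeff-zero (Q ^s suc (suc p) ⊛ G (suc p)) m)
  coeff (suc n) m = begin
    + ∑< (suc (suc p)) h                                   ≡⟨ cong +_ (∑<-suc (suc p) h) ⟩
    + (∑< (suc p) h ℕ.+ h (suc p))                         ≡⟨ cong +_ (cong₂ ℕ._+_ (∑<-zero (suc p) h λ b b<p+1 →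
                                                                walksVia-≤ n p true m b (ℕ.≤-pred b<p+1)) (walksVia-suc n p true m)) ⟩
    + walksAfter n (suc p) false m                         ≡⟨ walksAfter-series (suc p) false n m ⟩
    (Q ^s suc (suc p) ⊛ G (suc p)) n m                     ≡⟨ X⊛-coeff-suc (Q ^s suc (suc p) ⊛ G (suc p)) n m ⟨
    (X ⊛ (Q ^s suc (suc p) ⊛ G (suc p))) (suc n) m         ∎
    where
    open ≡.≡-Reasoning
    h : ℕ → ℕ
    h = walksVia n p true m

G≈ : ∀ p → G p ≈ 1s ⊕ X ⊛ (∑≤ˢ p (λ b → Q ^s suc b ⊛ H b) ⊕ Q ^s suc (suc p) ⊛ G (suc p))
G≈ p = mk≈ coeff
  where
  rest : Series
  rest = ∑≤ˢ p (λ b → Q ^s suc b ⊛ H b) ⊕ Q ^s suc (suc p) ⊛ G (suc p)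
  coeff : ∀ n m → G p n m ≡ (1s ⊕ X ⊛ rest) n m
  coeff zero    zero    = ≡.sym (cong (ℤ._+_ (+ 1)) (X⊛-coeff-zero rest 0))
  coeff zero    (suc m) = ≡.sym (cong (ℤ._+_ (+ 0)) (X⊛-coeff-zero rest (suc m)))
  coeff (suc n) m = begin
    + ∑< (suc (suc p)) h                          ≡⟨ cong +_ (∑<-suc (suc p) h) ⟩
    + (∑< (suc p) h ℕ.+ h (suc p))                ≡⟨ ℤ.pos-+ (∑< (suc p) h) (h (suc p)) ⟩
    + ∑< (suc p) h ℤ.+ + h (suc p)                ≡⟨ cong₂ ℤ._+_ (∑<-∑≤ p h) (cong +_ (walksVia-suc n p false m)) ⟩
    ∑≤ p (λ b → + h b) ℤ.+ + walksAfter n (suc p) false m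
                                                  ≡⟨ cong₂ ℤ._+_ (∑≤-cong≤ p first-below) (walksAfter-series (suc p) false n m) ⟩
    rest n m                                      ≡⟨ X⊛-coeff-suc rest n m ⟨
    (X ⊛ rest) (suc n) m                          ≡⟨ ℤ.+-identityˡ _ ⟨
    (1s ⊕ X ⊛ rest) (suc n) m                     ∎
    where
    open ≡.≡-Reasoning
    h : ℕ → ℕ
    h = walksVia n p false m
    first-below : ∀ b → b ≤ p → + h b ≡ (Q ^s suc b ⊛ H b) n m
    first-below b b≤p = ≡.trans (cong +_ (walksVia-≤ n p false m b b≤p)) (walksAfter-series b true n m)

Bser≈ : Bser ≈ X ⊛ (Q ^s 1 ⊛ G 0)
Bser≈ = mk≈ coeff
  where
  coeff : ∀ n m → Bser n m ≡ (X ⊛ (Q ^s 1 ⊛ G 0)) n m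
  coeff zero    m = ≡.sym (X⊛-coeff-zero (Q ^s 1 ⊛ G 0) m)
  coeff (suc n) m = ≡.trans (cong +_ (Bser-walks n m)) (≡.trans (walksAfter-series 0 false n m) (≡.sym (X⊛-coeff-suc (Q ^s 1 ⊛ G 0) n m)))

Γ : ℕ → Series
Γ zero    = 1s ⊕ Bser
Γ (suc p) = G p

constOne-Γ : ∀ k → ConstOne (Γ k)
constOne-Γ zero    = refl
constOne-Γ (suc p) = refl

qXΓ₁≈Γ₀-1 : (Q ⊛ X) ⊛ Γ 1 ≈ Γ 0 ⊖ 1s
qXΓ₁≈Γ₀-1 = ≈-trans (solve 3 (λ q x g → (q :* x) :* g := x :* ((q :* con (+ 1)) :* g)) ≈-refl Q X (G 0))
  (≈-trans (≈-sym Bser≈) (solve 1 (λ b → b := (con (+ 1) :+ b) :- con (+ 1)) ≈-refl Bser))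

Γ-step : ∀ k → Γ k ≈ A (suc k) ⊛ Γ (suc k) ⊖ B (suc k) ⊛ Γ (suc (suc k))
Γ-step zero    = linear-combination 1s (neg 1s) (neg (X ⊛ Q ^s 1)) Bser≈ (G≈ 0) (H≈ 0)
  (solve 7 (λ b q₁ q₂ x g₀ g₁ h₀ →
      (con (+ 1) :+ b) :- ((con (+ 1) :+ q₁ :* x) :* g₀ :- ((con (+ 1) :+ q₁ :* x) :* q₂ :* x) :* g₁)
   := con (+ 1) :* (b :- x :* (q₁ :* g₀))
      :+ (:- con (+ 1)) :* (g₀ :- (con (+ 1) :+ x :* (q₁ :* h₀ :+ q₂ :* g₁)))
      :+ (:- (x :* q₁)) :* (h₀ :- x :* (q₂ :* g₁)))
    ≈-refl Bser (Q ^s 1) (Q ^s 2) X (G 0) (G 1) (H 0))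
Γ-step (suc h) = linear-combination 1s (neg 1s) (neg (X ⊛ a)) (G≈ h) (G≈ (suc h)) (H≈ (suc h))
  (solve 8 (λ a b x t g₀ g₁ g₂ h₁ →
      g₀ :- ((con (+ 1) :+ a :* x) :* g₁ :- ((con (+ 1) :+ a :* x) :* b :* x) :* g₂)
   := con (+ 1) :* (g₀ :- (con (+ 1) :+ x :* (t :+ a :* g₁)))
      :+ (:- con (+ 1)) :* (g₁ :- (con (+ 1) :+ x :* ((t :+ a :* h₁) :+ b :* g₂)))
      :+ (:- (x :* a)) :* (h₁ :- x :* (b :* g₂)))
    ≈-refl a (Q ^s suc (suc (suc h))) X (∑≤ˢ h (λ b → Q ^s suc b ⊛ H b)) (G h) (G (suc h)) (G (suc (suc h))) (H (suc h)))
  where a = Q ^s suc (suc h)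

Γ-riccati : Riccati (λ k → Γ k ⊘ Γ (suc k))
Γ-riccati = ratios-riccati constOne-Γ Γ-step

cfValue-Γ : cfValue (Γ 0 ⊘ Γ 1) ≈ 1s ⊕ Bser
cfValue-Γ = ≈-trans (cfValue-quotient 1s (Γ 0) (Γ 1) refl refl refl qXΓ₁≈Γ₀-1) (⊘-identityʳ (Γ 0))

1+Bser≈D₁⊘D₀ : 1s ⊕ Bser ≈ D 1 ⊘ D 0
1+Bser≈D₁⊘D₀ = begin
  1s ⊕ Bser             ≈⟨ cfValue-Γ ⟨
  cfValue (Γ 0 ⊘ Γ 1)   ≈⟨ cfValue-unique Γ-riccati D⊘E-riccati ⟩
  cfValue (D 1 ⊘ E 1)   ≈⟨ cfValue-quotient (D 0) (D 1) (E 1) refl refl (constOne-E 1) qXE₁≈D₁-D₀ ⟩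
  D 1 ⊘ D 0             ∎
  where open ≈-Reasoning setoid

Bser⊛Den≈Num : Bser ⊛ Den ≈ Num
Bser⊛Den≈Num = begin
  Bser ⊛ Den                ≈⟨ *-congˡ {Bser} Den≈D0 ⟩
  Bser ⊛ D 0                ≈⟨ solve 2 (λ b d → b :* d := (con (+ 1) :+ b) :* d :- d) ≈-refl Bser (D 0) ⟩
  (1s ⊕ Bser) ⊛ D 0 ⊖ D 0   ≈⟨ +-congʳ (*-congʳ {D 0} 1+Bser≈D₁⊘D₀) ⟩
  (D 1 ⊘ D 0) ⊛ D 0 ⊖ D 0   ≈⟨ +-congʳ (⊘-⊛-cancel (D 1) (D 0) refl) ⟩
  D 1 ⊖ D 0                 ≈⟨ Num≈D1-D0 ⟨
  Num                       ∎
  where open ≈-Reasoning setoid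

theorem4p1 : ((n m : ℕ) → Bser n m ≡ (Num ⊘ Den) n m)
    × ((n m : ℕ) → ∃ λ d₀ → (d : ℕ) → d₀ ≤ d → CF d n m ≡ (1s ⊕ Bser) n m)
theorem4p1 = at (⊘-unique Den refl Bser⊛Den≈Num)
           , λ n m → suc n , λ d n<d → ≡.trans (at< (CF-≈[] Γ-riccati d) n m n<d) (at cfValue-Γ n m)
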